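{- Let $\mathcal R=(\mathcal F,\Pi,\mu,E,H,R)$ be an $E$-terminating EGTRS such that every rule of $R\cup\overleftrightarrow E$ is left-$\mu$-homogeneous and $\mu$-compatible. If every conditional pair in $\mathsf{LCCP}(\mathcal R)\cup\mathsf{LCCP}(E,\mathcal R)$ is joinable modulo $E$ w.r.t. $\to_{\mathcal R,E}$, then $\mathcal R$ is $E$-confluent.
   Context: Terms over a signature $\mathcal F$ and countable variables $\mathcal X$; $t|_p$, $t[s]_p$, root position $\Lambda$ standard. A replacement map $\mu$ assigns to each $k$-ary $f$ a set $\mu(f)\subseteq\{1,..,k\}$; active positions: $\mathcal{P}os^\mu(x)=\{\Lambda\}$, $\mathcal{P}os^\mu(f(t_1,..,t_k))=\{\Lambda\}\cup\{i.q\mid i\in\mu(f),q\in\mathcal{P}os^\mu(t_i)\}$; $\mathcal{P}os^\mu_{\mathcal F}(t)$ the active positions with a function symbol; $\mathcal{V}ar^\mu(t)$ (resp. $\overline{\mathcal{V}ar}^\mu(t)$) the variables with an active (resp. non-active) occurrence. A rule $\ell\to r\Leftarrow c$ is left-$\mu$-homogeneous if $\mathcal{V}ar^\mu(\ell)\cap\overline{\mathcal{V}ar}^\mu(\ell)=\emptyset$, and $\mu$-compatible if $\mathcal{V}ar^\mu(\ell)\cap\overline{\mathcal{V}ar}^\mu(r)=\emptyset$ and no variable of $\mathcal{V}ar^\mu(\ell)$ occurs in $c$. An EGTRS is $\mathcal R=(\mathcal F,\Pi,\mu,E,H,R)$ with $\Pi$ a predicate signature containing binary $=,\to,\to^*$;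 $E$ conditional equations $s=t\Leftarrow c$; $H$ definite Horn clauses $A\Leftarrow c$ with head predicate not $=,\to,\to^*$; $R$ rules $\ell\to r\Leftarrow c$, $\ell\notin\mathcal X$; each $c$ a finite sequence of atoms; it is assumed that $=$ does not depend on $R$ (a predicate $P$ depends on $R$ if $P\in\{\to,\to^*\}$ or some clause of $E\cup H$ with head predicate $P$ has a body atom whose predicate depends on $R$). $\overleftrightarrow E=\{s\to t\Leftarrow c,\ t\to s\Leftarrow c\mid s=t\Leftarrow c\in E\}$. $R^{rm}$: $R$ with $\approx$ replaced by new $\approx_{rm}$; $H^{rm}$: $H$ with $\approx,\to,\to^*$ replaced by new $\approx_{rm},\to_{rm},\to^*_{rm}$. $\mathsf{Th}^{CR}$: universal closures of (a) reflexivity, symmetry, transitivity of $=$, $x_i=y_i\Rightarrow f(..x_i..)=f(..y_i..)$ ($i\in\mu(f)$), $A_1\wedge..\wedge A_n\Rightarrow s=t$ for equations of $E$; (b) $x\to^*x$, $x\to y\wedge y\to^*z\Rightarrow x\to^*z$, $x_i\to y_i\Rightarrow f(..x_i..)\to f(..y_i..)$ ($i\in\mu(f)$), $A_1\wedge..\wedge A_n\Rightarrow\ell\to r$ for rules of $R^{rm}$; (c) $x\to^*_{ps}x$, $x\to_{ps}y\wedge y\to^*_{ps}z\Rightarrow x\to^*_{ps}z$, $\to_{ps}$-propagation for $i\in\mu(f)$, $x=\ell\wedge A_1\wedge..\wedge A_n\Rightarrow x\to_{ps}r$ ($x$ fresh) for rules of $R^{rm}$; (d) $x\to^*_{rm}x$,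 $x\to_{rm}y\wedge y\to^*_{rm}z\Rightarrow x\to^*_{rm}z$, $x=x'\wedge x'\to y'\wedge y'=y\Rightarrow x\to_{rm}y$; (e) the clauses of $H^{rm}$. $s\to_{\mathcal R,E}t$ / $s\to_{\mathcal R/E}t$ iff $s\to_{ps}t$ / $s\to_{rm}t$ is deducible from $\mathsf{Th}^{CR}$; $s=_Et$ iff $s=t$ is deducible from (a) plus the clauses of $H$. $\mathcal R$ is $E$-terminating if there is no infinite $\to_{\mathcal R/E}$-sequence; $E$-confluent if whenever $t\to^*_{\mathcal R/E}t_1$ and $t\to^*_{\mathcal R/E}t_2$ there are $t_1',t_2'$ with $t_i\to^*_{\mathcal R/E}t_i'$ and $t_1'=_Et_2'$. A conditional pair $\langle s,t\rangle\Leftarrow A_1,..,A_n$ is joinable modulo $E$ w.r.t. $\to_{\mathcal R,E}$ if for every substitution $\sigma$ with each $\sigma(A_i)$ deducible from $\mathsf{Th}^{CR}$ there are $u,u'$ with $\sigma(s)\to^*_{\mathcal R,E}u$, $\sigma(t)\to^*_{\mathcal R,E}u'$, $u=_Eu'$. LCCP of variable-disjoint rules $\alpha:s\to t\Leftarrow c$, $\alpha':u\to v\Leftarrow d$ at $p\in\mathcal{P}os^\mu_{\mathcal F}(s)$: $\langle s[v]_p,t\rangle\Leftarrow s|_p=u,c,d$; $\mathsf{LCCP}(\mathcal R)$: LCCPs with $\alpha,\alpha'\in R^{rm}$; $\mathsf{LCCP}(E,\mathcal R)$: LCCPs with $\alpha\in\overleftrightarrow E$, $\alpha'\in R^{rm}$.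 -}

module Defs where

open import Data.Nat using (ℕ)
open import Data.Fin using (Fin)
open import Data.Bool using (Bool; true; false)
open import Data.Vec using (Vec; []; _∷_; lookup; _[_]≔_)
open import Data.List using (List; []; _∷_; map; _++_)
open import Data.List.Relation.Unary.All using (All)
open import Data.List.Relation.Unary.Any using (Any)
open import Data.List.Relation.Binary.Pointwise using (Pointwise)
open import Data.Product using (Σ; ∃; ∃-syntax; _×_; _,_)
open import Data.Sum using (_⊎_)
open import Data.Empty using (⊥)
open import Data.Unit using (⊤)
open import Relation.Binary.PropositionalEquality using (_≡_)
open import Relation.Nullary using (¬_)
open import Relation.Binary.Construct.Closure.ReflexiveTransitive using (Star)
open import Induction.WellFounded using (WellFounded)
open import Function.Definitions using (Injective)

-- Signatures: function symbols F with arities, and the "other" predicate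
-- symbols of Π (besides the built-in binary =, →, →*) with arities.

record Sig : Set₁ where
  field
    Fun    : Set
    arity  : Fun → ℕ
    Prd    : Set
    parity : Prd → ℕ

module Syntax (S : Sig) where
  open Sig S

  data Term : Set where
    var : ℕ → Term
    fun : (f : Fun) → Vec Term (arity f) → Term

  Subst : Set
  Subst = ℕ → Term

  mutual
    _⟦_⟧ : Term → Subst → Term
    var x    ⟦ σ ⟧ = σ x
    fun f ts ⟦ σ ⟧ = fun f (ts ⟦ σ ⟧*)

    _⟦_⟧* : ∀ {n} → Vec Term n → Subst → Vec Term n
    []       ⟦ σ ⟧* = []
    (t ∷ ts) ⟦ σ ⟧* = (t ⟦ σ ⟧) ∷ (ts ⟦ σ ⟧*)

  IsFun : Term → Set
  IsFun (var _)   = ⊥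
  IsFun (fun _ _) = ⊤

  -- replacement map: μ f i ≡ true  iff  i ∈ μ(f)
  ReplacementMap : Set
  ReplacementMap = (f : Fun) → Fin (arity f) → Bool

  data Occ (x : ℕ) : Term → Set where
    here : Occ x (var x)
    arg  : ∀ {f ts} (i : Fin (arity f)) → Occ x (lookup ts i) → Occ x (fun f ts)

  module _ (μ : ReplacementMap) where
    data ActOcc (x : ℕ) : Term → Set where
      here : ActOcc x (var x)
      arg  : ∀ {f ts} (i : Fin (arity f)) → μ f i ≡ true →
             ActOcc x (lookup ts i) → ActOcc x (fun f ts)

    data FrozenOcc (x : ℕ) : Term → Set where
      frozen : ∀ {f ts} (i : Fin (arity f)) → μ f i ≡ false →
               Occ x (lookup ts i) → FrozenOcc x (fun f ts)
      arg    : ∀ {f ts} (i : Fin (arity f)) →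
               FrozenOcc x (lookup ts i) → FrozenOcc x (fun f ts)

    data APos : Term → Set where
      root : ∀ {t} → APos t
      arg  : ∀ {f ts} (i : Fin (arity f)) → μ f i ≡ true →
             APos (lookup ts i) → APos (fun f ts)

    _∣_ : (t : Term) → APos t → Term
    t        ∣ root        = t
    fun f ts ∣ arg i _ p   = lookup ts i ∣ p

    _[_≔_] : (t : Term) → APos t → Term → Term
    t        [ root ≔ u ]      = u
    fun f ts [ arg i _ p ≔ u ] = fun f (ts [ i ]≔ (lookup ts i [ p ≔ u ]))

  data Pred : Set where
    eqP rwP rwsP : Pred
    usr : Prd → Pred

  arP : Pred → ℕ
  arP eqP     = 2
  arP rwP     = 2
  arP rwsP    = 2
  arP (usr p) = parity p

  data Atom : Set where
    _⟨_⟩ : (π : Pred) → Vec Term (arP π) → Atom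

  -- extended predicates used in Th^CR: Π plus →ps, →*ps, →rm, →*rm, ≈rm
  data XPred : Set where
    base : Pred → XPred
    psP psSP rmP rmSP : XPred
    urm : Prd → XPred

  arX : XPred → ℕ
  arX (base π) = arP π
  arX psP      = 2
  arX psSP     = 2
  arX rmP      = 2
  arX rmSP     = 2
  arX (urm p)  = parity p

  data XAtom : Set where
    _⟨_⟩ₓ : (π : XPred) → Vec Term (arX π) → XAtom

  embed : Atom → XAtom
  embed (π ⟨ ts ⟩) = base π ⟨ ts ⟩ₓ

  substA : Subst → Atom → Atom
  substA σ (π ⟨ ts ⟩) = π ⟨ ts ⟦ σ ⟧* ⟩

  substX : Subst → XAtom → XAtom
  substX σ (π ⟨ ts ⟩ₓ) = π ⟨ ts ⟦ σ ⟧* ⟩ₓ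

  data OccA (x : ℕ) : Atom → Set where
    occ : ∀ {π ts} (i : Fin (arP π)) → Occ x (lookup ts i) → OccA x (π ⟨ ts ⟩)

  data OccX (x : ℕ) : XAtom → Set where
    occ : ∀ {π ts} (i : Fin (arX π)) → Occ x (lookup ts i) → OccX x (π ⟨ ts ⟩ₓ)

  predOf : Atom → Pred
  predOf (π ⟨ _ ⟩) = π

  _≐_ _⟶_ _⟶*_ _⟶ps_ _⟶ps*_ _⟶rm_ _⟶rm*_ : Term → Term → XAtom
  s ≐ t     = base eqP  ⟨ s ∷ t ∷ [] ⟩ₓ
  s ⟶ t     = base rwP  ⟨ s ∷ t ∷ [] ⟩ₓ
  s ⟶* t    = base rwsP ⟨ s ∷ t ∷ [] ⟩ₓ
  s ⟶ps t   = psP       ⟨ s ∷ t ∷ [] ⟩ₓ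
  s ⟶ps* t  = psSP      ⟨ s ∷ t ∷ [] ⟩ₓ
  s ⟶rm t   = rmP       ⟨ s ∷ t ∷ [] ⟩ₓ
  s ⟶rm* t  = rmSP      ⟨ s ∷ t ∷ [] ⟩ₓ

  _≐ₐ_ : Term → Term → Atom
  s ≐ₐ t = eqP ⟨ s ∷ t ∷ [] ⟩

  -- EGTRS (F, Π, μ, E, H, R); the sets E, H, R are given by membership
  -- predicates; a conditional equation s = t ⇐ c is E s t c, a Horn clause
  -- P(ts) ⇐ c (P ∉ {=,→,→*}) is H P ts c, a rule ℓ → r ⇐ c is R ℓ r c.
  record EGTRS : Set₁ where
    field
      μ        : ReplacementMap
      E        : Term → Term → List Atom → Set
      H        : (p : Prd) → Vec Term (parity p) → List Atom → Set
      R        : Term → Term → List Atom → Set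
      R-nonvar : ∀ {l r c} → R l r c → IsFun l

  record XRule : Set where
    constructor rule
    field
      lhs  : Term
      rhs  : Term
      cond : List XAtom

  record CondPair : Set where
    constructor pair
    field
      left  : Term
      right : Term
      cond  : List XAtom

  module Semantics (𝓡 : EGTRS) where
    open EGTRS 𝓡

    substC : Subst → List XAtom → List XAtom
    substC σ c = map (substX σ) c

    substCA : Subst → List Atom → List Atom
    substCA σ c = map (substA σ) c

    data DependsOnR : Pred → Set where
      dep-rw  : DependsOnR rwP
      dep-rws : DependsOnR rwsP
      dep-E   : ∀ {s t c} → E s t c →
                Any (λ a → DependsOnR (predOf a)) c → DependsOnR eqP
      dep-H   : ∀ {p ts c} → H p ts c →
                Any (λ a → DependsOnR (predOf a)) c → DependsOnR (usr p)

    -- standing assumption of an EGTRS: = does not depend on R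
    IsEGTRS : Set
    IsEGTRS = ¬ DependsOnR eqP

    -- the "rm" renaming: →, →* and every predicate depending on R are
    -- replaced by their rm-versions; = and predicates not depending on R stay
    data RmAtom : Atom → XAtom → Set where
      rm-eq    : ∀ {ts} → RmAtom (eqP ⟨ ts ⟩) (base eqP ⟨ ts ⟩ₓ)
      rm-rw    : ∀ {ts} → RmAtom (rwP ⟨ ts ⟩) (rmP ⟨ ts ⟩ₓ)
      rm-rws   : ∀ {ts} → RmAtom (rwsP ⟨ ts ⟩) (rmSP ⟨ ts ⟩ₓ)
      rm-dep   : ∀ {p ts} → DependsOnR (usr p) →
                 RmAtom (usr p ⟨ ts ⟩) (urm p ⟨ ts ⟩ₓ)
      rm-indep : ∀ {p ts} → ¬ DependsOnR (usr p) →
                 RmAtom (usr p ⟨ ts ⟩) (base (usr p) ⟨ ts ⟩ₓ)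

    data Rrm : XRule → Set where
      rrm : ∀ {l r c c'} → R l r c → Pointwise RmAtom c c' → Rrm (rule l r c')

    data ↔E : XRule → Set where
      fwd : ∀ {s t c} → E s t c → ↔E (rule s t (map embed c))
      bwd : ∀ {s t c} → E s t c → ↔E (rule t s (map embed c))

    -- deducibility from Th^CR
    data ⊢ : XAtom → Set where
      eq-refl  : ∀ t → ⊢ (t ≐ t)
      eq-sym   : ∀ {s t} → ⊢ (s ≐ t) → ⊢ (t ≐ s)
      eq-trans : ∀ {s t u} → ⊢ (s ≐ t) → ⊢ (t ≐ u) → ⊢ (s ≐ u)
      eq-cong  : ∀ f (ts : Vec Term (arity f)) (i : Fin (arity f)) u →
                 μ f i ≡ true → ⊢ (lookup ts i ≐ u) →
                 ⊢ (fun f ts ≐ fun f (ts [ i ]≔ u))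
      eq-E     : ∀ {s t c} → E s t c → (σ : Subst) →
                 All ⊢ (substC σ (map embed c)) → ⊢ ((s ⟦ σ ⟧) ≐ (t ⟦ σ ⟧))
      rws-refl : ∀ t → ⊢ (t ⟶* t)
      rws-step : ∀ {s t u} → ⊢ (s ⟶ t) → ⊢ (t ⟶* u) → ⊢ (s ⟶* u)
      rw-cong  : ∀ f (ts : Vec Term (arity f)) (i : Fin (arity f)) u →
                 μ f i ≡ true → ⊢ (lookup ts i ⟶ u) →
                 ⊢ (fun f ts ⟶ fun f (ts [ i ]≔ u))
      rw-rule  : ∀ {l r c} → Rrm (rule l r c) → (σ : Subst) →
                 All ⊢ (substC σ c) → ⊢ ((l ⟦ σ ⟧) ⟶ (r ⟦ σ ⟧))
      pss-refl : ∀ t → ⊢ (t ⟶ps* t)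
      pss-step : ∀ {s t u} → ⊢ (s ⟶ps t) → ⊢ (t ⟶ps* u) → ⊢ (s ⟶ps* u)
      ps-cong  : ∀ f (ts : Vec Term (arity f)) (i : Fin (arity f)) u →
                 μ f i ≡ true → ⊢ (lookup ts i ⟶ps u) →
                 ⊢ (fun f ts ⟶ps fun f (ts [ i ]≔ u))
      ps-rule  : ∀ {l r c} → Rrm (rule l r c) → (σ : Subst) → (t : Term) →
                 ⊢ (t ≐ (l ⟦ σ ⟧)) → All ⊢ (substC σ c) → ⊢ (t ⟶ps (r ⟦ σ ⟧))
      rms-refl : ∀ t → ⊢ (t ⟶rm* t)
      rms-step : ∀ {s t u} → ⊢ (s ⟶rm t) → ⊢ (t ⟶rm* u) → ⊢ (s ⟶rm* u)
      rm-def   : ∀ {x x' y' y} → ⊢ (x ≐ x') → ⊢ (x' ⟶ y') → ⊢ (y' ≐ y) →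
                 ⊢ (x ⟶rm y)
      h-rm     : ∀ {p ts c A' c'} → H p ts c → RmAtom (usr p ⟨ ts ⟩) A' →
                 Pointwise RmAtom c c' → (σ : Subst) →
                 All ⊢ (substC σ c') → ⊢ (substX σ A')

    data ⊢E : Atom → Set where
      eq-refl  : ∀ t → ⊢E (t ≐ₐ t)
      eq-sym   : ∀ {s t} → ⊢E (s ≐ₐ t) → ⊢E (t ≐ₐ s)
      eq-trans : ∀ {s t u} → ⊢E (s ≐ₐ t) → ⊢E (t ≐ₐ u) → ⊢E (s ≐ₐ u)
      eq-cong  : ∀ f (ts : Vec Term (arity f)) (i : Fin (arity f)) u →
                 μ f i ≡ true → ⊢E (lookup ts i ≐ₐ u) →
                 ⊢E (fun f ts ≐ₐ fun f (ts [ i ]≔ u))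
      eq-E     : ∀ {s t c} → E s t c → (σ : Subst) →
                 All ⊢E (substCA σ c) → ⊢E ((s ⟦ σ ⟧) ≐ₐ (t ⟦ σ ⟧))
      h        : ∀ {p ts c} → H p ts c → (σ : Subst) →
                 All ⊢E (substCA σ c) → ⊢E (substA σ (usr p ⟨ ts ⟩))

    _→RE_ : Term → Term → Set
    s →RE t = ⊢ (s ⟶ps t)

    _→R/E_ : Term → Term → Set
    s →R/E t = ⊢ (s ⟶rm t)

    _=E_ : Term → Term → Set
    s =E t = ⊢E (s ≐ₐ t)

    ETerminating : Set
    ETerminating = WellFounded (λ y x → x →R/E y)

    EConfluent : Set
    EConfluent = ∀ {t t₁ t₂} → Star _→R/E_ t t₁ → Star _→R/E_ t t₂ →
      ∃[ t₁' ] ∃[ t₂' ] (Star _→R/E_ t₁ t₁' × Star _→R/E_ t₂ t₂' × t₁' =E t₂')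

    LeftHomogeneous : Term → Set
    LeftHomogeneous l = ∀ x → ActOcc μ x l → FrozenOcc μ x l → ⊥

    Compatible : Term → Term → List Atom → Set
    Compatible l r c = ∀ x → ActOcc μ x l →
      ¬ FrozenOcc μ x r × ¬ Any (OccA x) c

    AllHomCompat : Set
    AllHomCompat =
      (∀ {l r c} → R l r c → LeftHomogeneous l × Compatible l r c) ×
      (∀ {s t c} → E s t c →
         (LeftHomogeneous s × Compatible s t c) ×
         (LeftHomogeneous t × Compatible t s c))

    data OccRule (x : ℕ) : XRule → Set where
      in-lhs  : ∀ {l r c} → Occ x l → OccRule x (rule l r c)
      in-rhs  : ∀ {l r c} → Occ x r → OccRule x (rule l r c)
      in-cond : ∀ {l r c} → Any (OccX x) c → OccRule x (rule l r c)

    renameRule : (ℕ → ℕ) → XRule → XRule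
    renameRule ρ (rule l r c) =
      rule (l ⟦ (λ x → var (ρ x)) ⟧) (r ⟦ (λ x → var (ρ x)) ⟧)
           (substC (λ x → var (ρ x)) c)

    data Variant (P : XRule → Set) : XRule → Set where
      variant : ∀ {α} (ρ : ℕ → ℕ) → Injective _≡_ _≡_ ρ → P α →
                Variant P (renameRule ρ α)

    VarDisjoint : XRule → XRule → Set
    VarDisjoint α β = ∀ x → OccRule x α → OccRule x β → ⊥

    data LCCPof : XRule → XRule → CondPair → Set where
      lccp : ∀ {s t c u v d} (p : APos μ s) → IsFun (_∣_ μ s p) →
             LCCPof (rule s t c) (rule u v d)
               (pair (_[_≔_] μ s p v) t ((_∣_ μ s p ≐ u) ∷ c ++ d))

    data LCCP-R : CondPair → Set where
      mk : ∀ {α β π} → Variant Rrm α → Variant Rrm β → VarDisjoint α β →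
           LCCPof α β π → LCCP-R π

    data LCCP-ER : CondPair → Set where
      mk : ∀ {α β π} → Variant ↔E α → Variant Rrm β → VarDisjoint α β →
           LCCPof α β π → LCCP-ER π

    Joinable : CondPair → Set
    Joinable (pair s t c) = ∀ (σ : Subst) → All ⊢ (substC σ c) →
      ∃[ u ] ∃[ u' ] (Star _→RE_ (s ⟦ σ ⟧) u × Star _→RE_ (t ⟦ σ ⟧) u' × u =E u')

{-# OPTIONS --safe #-}
module Submission where

-- Huet's confluence-modulo argument, in the form of Jouannaud and Kirchner. A →R/E step is a
-- →R,E step between E-equal terms and →R/E is well founded, so it suffices to show, by
-- induction along →R/E⁺, that →R,E is Church–Rosser on every E-class. The induction step needs
-- local coherence of →R,E with single E-steps and local confluence of →R,E; a step whose redex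
-- is matched only modulo E is first moved, by coherence, along the E-chain to a syntactic redex.
-- Both properties then come down to a peak at the root of an instance ℓσ. Either the other step
-- overlaps ℓ at a non-variable position, and the peak is an instance of a renamed-apart LCCP,
-- joinable by hypothesis; or it rewrites inside some σ(x), and left-μ-homogeneity and
-- μ-compatibility let it be repeated at every occurrence of x on both sides.

open import Defs
open import Data.Bool using (Bool; true; false)
open import Data.Empty using (⊥-elim)
open import Data.Fin using (Fin; zero; suc)
import Data.Fin as Fin
open import Data.List using (List; []; _∷_; map; _++_; length)
open import Data.List.Properties using (map-∘; map-cong; map-id; map-++; length-++)
open import Data.List.Relation.Binary.Pointwise using (Pointwise; []; _∷_)
open import Data.List.Relation.Unary.All using (All; []; _∷_)
open import Data.List.Relation.Unary.All.Properties using (++⁺; ¬Any⇒All¬)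
open import Data.List.Relation.Unary.Any using (Any; here; there)
open import Data.Nat using (ℕ; zero; suc; _+_; _∸_; _≤_; _<_; _⊔_; _≟_; _≤?_; s≤s)
open import Data.Nat.Properties
  using ( ≤-refl; ≤-trans; ≤-pred; m≤m+n; m≤m⊔n; m≤n⊔m; 1+n≰n; m+n∸m≡n; m+n≤o⇒m≤o
        ; +-suc; +-assoc; +-cancelˡ-≡)
open import Data.Product using (∃; ∃₂; _×_; _,_; proj₁; proj₂)
open import Data.Sum using (_⊎_; inj₁; inj₂)
open import Data.Unit using (⊤; tt)
open import Data.Vec using (Vec; []; _∷_; lookup; _[_]≔_)
open import Data.Vec.Properties
  using ([]≔-idempotent; []≔-commutes; []≔-lookup; lookup∘update; lookup∘update′)
open import Function using (flip; id; _∘_)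
open import Induction.WellFounded using (WellFounded; Acc; acc; module Subrelation)
open import Level using (0ℓ)
open import Relation.Binary using (Rel; _⇒_; Symmetric; IsEquivalence)
open import Relation.Binary.Construct.Closure.ReflexiveTransitive
  using (Star; ε; _◅_; _◅◅_; gmap; reverse)
open import Relation.Binary.Construct.Closure.Transitive as Plus using (TransClosure; [_]; _∷_; _∷ʳ_)
open import Relation.Binary.PropositionalEquality
  using (_≡_; _≢_; refl; sym; trans; cong; cong₂; subst; subst₂; module ≡-Reasoning)
open import Relation.Nullary using (¬_; yes; no)

-- ↦ plays →R,E, ≈ a single E-step, ~ the E-equality it generates, and ▷ = ~·↦·~ plays →R/E.
module ChurchRosserModulo
  {A : Set} (_↦_ _≈_ _~_ _▷_ : Rel A 0ℓ)
  (~-isEquivalence : IsEquivalence _~_)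
  (≈-sym : Symmetric _≈_) (≈⊆~ : _≈_ ⇒ _~_) (~⊆≈* : _~_ ⇒ Star _≈_)
  (↦⊆▷ : _↦_ ⇒ _▷_)
  (▷-resp-~ : ∀ {x x′ y y′} → x ~ x′ → x′ ▷ y → y ~ y′ → x ▷ y′)
  (▷-split : ∀ {x y} → x ▷ y → ∃₂ λ x′ y′ → x ~ x′ × x′ ↦ y′ × y′ ~ y)
  where

  open IsEquivalence ~-isEquivalence
    renaming (refl to ~-refl; sym to ~-sym; trans to ~-trans)

  infix 4 _↓_ _⇊_ _▷⁺_

  _↓_ : Rel A 0ℓ
  a ↓ b = ∃₂ λ a′ b′ → Star _↦_ a a′ × Star _↦_ b b′ × a′ ~ b′

  ↓-sym : Symmetric _↓_
  ↓-sym (a′ , b′ , p , q , e) = b′ , a′ , q , p , ~-sym e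

  ↦*⇒↓ : ∀ {a b} → Star _↦_ b a → a ↓ b
  ↦*⇒↓ p = _ , _ , ε , p , ~-refl

  ↓-↦*ˡ : ∀ {x a b} → Star _↦_ x a → a ↓ b → x ↓ b
  ↓-↦*ˡ p (a′ , b′ , q , r , e) = a′ , b′ , p ◅◅ q , r , e

  _▷⁺_ : Rel A 0ℓ
  _▷⁺_ = TransClosure _▷_

  ▷⁺-↦* : ∀ {x y z} → x ▷⁺ y → Star _↦_ y z → x ▷⁺ z
  ▷⁺-↦* p ε        = p
  ▷⁺-↦* p (s ◅ ss) = ▷⁺-↦* (p ∷ʳ ↦⊆▷ s) ss

  ▷⁺-~ : ∀ {x y z} → x ▷⁺ y → y ~ z → x ▷⁺ z
  ▷⁺-~ [ s ]    e = [ ▷-resp-~ ~-refl s e ]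
  ▷⁺-~ (s ∷ ss) e = s ∷ ▷⁺-~ ss e

  ▷⁺-reverse : ∀ {x y} → x ▷⁺ y → TransClosure (flip _▷_) y x
  ▷⁺-reverse [ s ]    = [ s ]
  ▷⁺-reverse (s ∷ ss) = ▷⁺-reverse ss ∷ʳ s

  ChurchRosserAt : A → Set
  ChurchRosserAt c = ∀ {y₁ y₂ a b} → y₁ ~ c → y₂ ~ c →
    Star _↦_ y₁ a → Star _↦_ y₂ b → a ↓ b

  ChurchRosserBelow : A → Set
  ChurchRosserBelow t = ∀ {c} → t ▷⁺ c → ChurchRosserAt c

  LocallyCoherent : Set
  LocallyCoherent = ∀ {x y w} → x ≈ y → x ↦ w → w ↓ y

  LocallyConfluentAt : A → Set
  LocallyConfluentAt t = ∀ {t₀ t₁ b} → t₀ ~ t → t₀ ↦ t₁ → Star _↦_ t₀ b → t₁ ↓ b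

  -- Length-indexed so that ↓-chain may recurse on the reversed chain.
  data Chain : ℕ → A → A → Set where
    []  : ∀ {x} → Chain zero x x
    _∷_ : ∀ {n x y z} → x ≈ y → Chain n y z → Chain (suc n) x z

  _∷ʳᶜ_ : ∀ {n x y z} → Chain n x y → y ≈ z → Chain (suc n) x z
  []         ∷ʳᶜ s = s ∷ []
  (x≈y ∷ ch) ∷ʳᶜ s = x≈y ∷ (ch ∷ʳᶜ s)

  Chain-reverse : ∀ {n x y} → Chain n x y → Chain n y x
  Chain-reverse []         = []
  Chain-reverse (x≈y ∷ ch) = Chain-reverse ch ∷ʳᶜ ≈-sym x≈y

  Chain⇒~ : ∀ {n x y} → Chain n x y → x ~ y
  Chain⇒~ []         = ~-refl
  Chain⇒~ (x≈y ∷ ch) = ~-trans (≈⊆~ x≈y) (Chain⇒~ ch)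

  Star⇒Chain : ∀ {x y} → Star _≈_ x y → ∃ λ n → Chain n x y
  Star⇒Chain ε = zero , []
  Star⇒Chain (x≈y ◅ ss) with Star⇒Chain ss
  ... | n , ch = suc n , x≈y ∷ ch

  _⇊_ : Rel A 0ℓ
  a ⇊ b = ∃₂ λ a′ b′ → Star _▷_ a a′ × Star _▷_ b b′ × a′ ~ b′

  ~-▷* : ∀ {x y z} → x ~ y → Star _▷_ y z → ∃ λ w → Star _▷_ x w × w ~ z
  ~-▷* e ε        = _ , ε , e
  ~-▷* e (s ◅ ss) = _ , ▷-resp-~ e s ~-refl ◅ ss , ~-refl

  ~-↦* : ∀ {x y z} → x ~ y → Star _↦_ y z → ∃ λ w → Star _▷_ x w × w ~ z
  ~-↦* e ss = ~-▷* e (gmap id ↦⊆▷ ss)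

  ▷⁺-▷* : ∀ {x y z} → x ▷ y → Star _▷_ y z → x ▷⁺ z
  ▷⁺-▷* s ε         = [ s ]
  ▷⁺-▷* s (s′ ◅ ss) = s ∷ ▷⁺-▷* s′ ss

  module _ (▷-wellFounded : WellFounded (flip _▷_)) where

    ▷⁺-wellFounded : WellFounded (flip _▷⁺_)
    ▷⁺-wellFounded =
      Subrelation.wellFounded ▷⁺-reverse (Plus.wellFounded (flip _▷_) ▷-wellFounded)

    module Below (t : A) (ih : ChurchRosserBelow t) where

      ▷⁺-↦ : ∀ {t₀ t₁} → t₀ ~ t → t₀ ↦ t₁ → t ▷⁺ t₁
      ▷⁺-↦ e s = [ ▷-resp-~ (~-sym e) (↦⊆▷ s) ~-refl ]

      ↓-across-↦* : ∀ {c} → Acc (flip _▷⁺_) c → t ▷⁺ c →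
        ∀ {X Y c′} → X ~ c → Star _↦_ c c′ → c′ ~ Y → X ↓ Y
      ↓-across-↦* _ _ e₁ ε e₂ = _ , _ , ε , ε , ~-trans e₁ e₂
      ↓-across-↦* (acc rs) t▷⁺c e₁ (s ◅ ss) e₂ with ih t▷⁺c ~-refl e₁ (s ◅ ss) ε
      ... | d , X′ , c′↦*d , X↦*X′ , d~X′ =
        ↓-↦*ˡ X↦*X′ (↓-sym (↓-across-↦* (rs c▷⁺c′) (▷⁺-↦* (t▷⁺c ∷ʳ ↦⊆▷ s) ss) (~-sym e₂) c′↦*d d~X′))
        where c▷⁺c′ = ▷⁺-↦* [ ↦⊆▷ s ] ss

      ↓-trans : ∀ {a b c c′} → t ▷⁺ c → a ↓ c → c ~ c′ → c′ ↓ b → a ↓ b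
      ↓-trans t▷⁺c (a₂ , c₂ , a↦*a₂ , c↦*c₂ , a₂~c₂) c~c′ (c₄ , b₄ , c′↦*c₄ , b↦*b₄ , c₄~b₄)
        with ih t▷⁺c ~-refl (~-sym c~c′) c↦*c₂ c′↦*c₄
      ... | c₅ , c₆ , c₂↦*c₅ , c₄↦*c₆ , c₅~c₆
        with ↓-across-↦* (▷⁺-wellFounded c₂) (▷⁺-↦* t▷⁺c c↦*c₂) a₂~c₂ c₂↦*c₅ c₅~c₆
      ... | a₇ , c₇ , a₂↦*a₇ , c₆↦*c₇ , a₇~c₇
        with ↓-across-↦* (▷⁺-wellFounded c₄) (▷⁺-↦* (▷⁺-~ t▷⁺c c~c′) c′↦*c₄) (~-sym c₄~b₄)
               (c₄↦*c₆ ◅◅ c₆↦*c₇) (~-sym a₇~c₇)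
      ... | b₈ , a₈ , b₄↦*b₈ , a₇↦*a₈ , b₈~a₈ =
        a₈ , b₈ , a↦*a₂ ◅◅ a₂↦*a₇ ◅◅ a₇↦*a₈ , b↦*b₄ ◅◅ b₄↦*b₈ , ~-sym b₈~a₈

      -- Every point of the ≈-chain rewrites to U in one step, so coherence carries local
      -- confluence at Z back to w₀.
      ↓-along-redex-chain : LocallyCoherent → ∀ {Q : A → Set} {U Z} →
        (∀ {w} → Q w → w ↦ U) → (∀ {Y} → Z ↦ Y → U ↓ Y) →
        ∀ {w₀} → w₀ ~ t → Star (λ a b → Q a × a ≈ b) w₀ Z → Q Z →
        ∀ {Y} → Star _↦_ w₀ Y → U ↓ Y
      ↓-along-redex-chain _ toU _ _ ε qZ ε = ↦*⇒↓ (toU qZ ◅ ε)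
      ↓-along-redex-chain _ _ lcZ e ε _ (s ◅ ss) =
        ↓-trans (▷⁺-↦ e s) (lcZ s) ~-refl (↓-sym (↦*⇒↓ ss))
      ↓-along-redex-chain _ toU _ _ ((q , _) ◅ _) _ ε = ↦*⇒↓ (toU q ◅ ε)
      ↓-along-redex-chain coh toU lcZ e ((_ , x≈y) ◅ ch) qZ (s ◅ ss) with coh x≈y s
      ... | c , d , Y₁↦*c , y↦*d , c~d =
        ↓-trans (▷⁺-~ (▷⁺-↦* (▷⁺-↦ e s) Y₁↦*c) c~d)
          (↓-along-redex-chain coh toU lcZ (~-trans (~-sym (≈⊆~ x≈y)) e) ch qZ y↦*d)
          (~-sym c~d) (ih (▷⁺-↦ e s) ~-refl ~-refl Y₁↦*c ss)

    module _ (coherent : LocallyCoherent) where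

      module InductionStep (t : A) (ih : ChurchRosserBelow t) (lc : LocallyConfluentAt t) where
        open Below t ih

        mutual
          ↓-after-step : ∀ n {t₀ t′ t₁ a b} → t₀ ~ t → Chain n t₀ t′ →
            t₀ ↦ t₁ → Star _↦_ t₁ a → Star _↦_ t′ b → a ↓ b
          ↓-after-step zero e [] s as bs = ↓-trans (▷⁺-↦ e s) (↦*⇒↓ as) ~-refl (lc e s bs)
          ↓-after-step (suc n) e (x≈y ∷ ch) s as bs with coherent x≈y s
          ... | c , d , t₁↦*c , y↦*d , c~d =
            ↓-trans (▷⁺-↦* (▷⁺-↦ e s) t₁↦*c) (ih (▷⁺-↦ e s) ~-refl ~-refl as t₁↦*c) c~d
              (↓-chain n (~-trans (~-sym (≈⊆~ x≈y)) e) ch y↦*d bs)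

          ↓-chain : ∀ n {t₀ t′ a b} → t₀ ~ t → Chain n t₀ t′ →
            Star _↦_ t₀ a → Star _↦_ t′ b → a ↓ b
          ↓-chain n e ch ε        ε        = _ , _ , ε , ε , Chain⇒~ ch
          ↓-chain n e ch (s ◅ as) bs       = ↓-after-step n e ch s as bs
          ↓-chain n e ch ε        (s ◅ bs) =
            ↓-sym (↓-after-step n (~-trans (~-sym (Chain⇒~ ch)) e) (Chain-reverse ch) s bs ε)

        churchRosserAt : ChurchRosserAt t
        churchRosserAt e₁ e₂ as bs with Star⇒Chain (~⊆≈* (~-trans e₁ (~-sym e₂)))
        ... | n , ch = ↓-chain n e₁ ch as bs

      churchRosser : (∀ t → ChurchRosserBelow t → LocallyConfluentAt t) → ∀ t → ChurchRosserAt t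
      churchRosser lc t = go (▷⁺-wellFounded t)
        where
        go : ∀ {t} → Acc (flip _▷⁺_) t → ChurchRosserAt t
        go {t} (acc rs) = InductionStep.churchRosserAt t ih (lc t ih)
          where
          ih : ChurchRosserBelow t
          ih t▷⁺c = go (rs t▷⁺c)

    confluentModulo : (∀ t → ChurchRosserAt t) →
      ∀ {t a b} → Star _▷_ t a → Star _▷_ t b → a ⇊ b
    confluentModulo cr {t} = go (▷⁺-wellFounded t) ~-refl
      where
      go : ∀ {t t′ a b} → Acc (flip _▷⁺_) t → t ~ t′ → Star _▷_ t a → Star _▷_ t′ b → a ⇊ b
      go _ e ε        ε        = _ , _ , ε , ε , e
      go _ e (s ◅ as) ε        = _ , _ , ε , ▷-resp-~ (~-sym e) s ~-refl ◅ as , ~-refl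
      go _ e ε        (s ◅ bs) = _ , _ , ▷-resp-~ e s ~-refl ◅ bs , ε , ~-refl
      go (acc rs) e (s ◅ as) (s′ ◅ bs) with ▷-split s | ▷-split s′
      ... | x , y , t~x , x↦y , y~a₁ | x′ , y′ , t′~x′ , x′↦y′ , y′~b₁
        with cr x ~-refl (~-trans (~-sym t′~x′) (~-trans (~-sym e) t~x)) (x↦y ◅ ε) (x′↦y′ ◅ ε)
      ... | y₂ , y₂′ , y↦*y₂ , y′↦*y₂′ , y₂~y₂′
        with ~-↦* (~-sym y~a₁) y↦*y₂ | ~-↦* (~-sym y′~b₁) y′↦*y₂′
      ... | z , a₁▷*z , z~y₂ | z′ , b₁▷*z′ , z′~y₂′
        with go (rs [ s ]) ~-refl as a₁▷*z | go (rs [ ▷-resp-~ e s′ ~-refl ]) ~-refl bs b₁▷*z′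
      ... | a₃ , z₃ , a▷*a₃ , z▷*z₃ , a₃~z₃ | b₃ , z₃′ , b▷*b₃ , z′▷*z₃′ , b₃~z₃′
        with go (rs (▷⁺-▷* s a₁▷*z)) (~-trans z~y₂ (~-trans y₂~y₂′ (~-sym z′~y₂′))) z▷*z₃ z′▷*z₃′
      ... | z₄ , z₄′ , z₃▷*z₄ , z₃′▷*z₄′ , z₄~z₄′
        with ~-▷* a₃~z₃ z₃▷*z₄ | ~-▷* b₃~z₃′ z₃′▷*z₄′
      ... | a₅ , a₃▷*a₅ , a₅~z₄ | b₅ , b₃▷*b₅ , b₅~z₄′ =
        a₅ , b₅ , a▷*a₃ ◅◅ a₃▷*a₅ , b▷*b₃ ◅◅ b₃▷*b₅ , ~-trans a₅~z₄ (~-trans z₄~z₄′ (~-sym b₅~z₄′))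

module Terms (S : Sig) where
  open Sig S
  open Syntax S

  lookup-⟦⟧* : ∀ {n} (ts : Vec Term n) i σ → lookup (ts ⟦ σ ⟧*) i ≡ lookup ts i ⟦ σ ⟧
  lookup-⟦⟧* (t ∷ ts) zero    σ = refl
  lookup-⟦⟧* (t ∷ ts) (suc i) σ = lookup-⟦⟧* ts i σ

  []≔-⟦⟧* : ∀ {n} (ts : Vec Term n) i u σ → (ts [ i ]≔ u) ⟦ σ ⟧* ≡ (ts ⟦ σ ⟧*) [ i ]≔ (u ⟦ σ ⟧)
  []≔-⟦⟧* (t ∷ ts) zero    u σ = refl
  []≔-⟦⟧* (t ∷ ts) (suc i) u σ = cong (t ⟦ σ ⟧ ∷_) ([]≔-⟦⟧* ts i u σ)

  mutual
    ⟦⟧-cong : ∀ t {σ τ : Subst} → (∀ x → Occ x t → σ x ≡ τ x) → t ⟦ σ ⟧ ≡ t ⟦ τ ⟧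
    ⟦⟧-cong (var x)    h = h x here
    ⟦⟧-cong (fun f ts) h = cong (fun f) (⟦⟧*-cong ts (λ x i o → h x (arg i o)))

    ⟦⟧*-cong : ∀ {n} (ts : Vec Term n) {σ τ : Subst} →
      (∀ x i → Occ x (lookup ts i) → σ x ≡ τ x) → ts ⟦ σ ⟧* ≡ ts ⟦ τ ⟧*
    ⟦⟧*-cong []       h = refl
    ⟦⟧*-cong (t ∷ ts) h =
      cong₂ _∷_ (⟦⟧-cong t (λ x → h x zero)) (⟦⟧*-cong ts (λ x i → h x (suc i)))

  mutual
    ⟦⟧-∘ : ∀ t (τ σ : Subst) → t ⟦ τ ⟧ ⟦ σ ⟧ ≡ t ⟦ (λ x → τ x ⟦ σ ⟧) ⟧
    ⟦⟧-∘ (var x)    τ σ = refl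
    ⟦⟧-∘ (fun f ts) τ σ = cong (fun f) (⟦⟧*-∘ ts τ σ)

    ⟦⟧*-∘ : ∀ {n} (ts : Vec Term n) (τ σ : Subst) → ts ⟦ τ ⟧* ⟦ σ ⟧* ≡ ts ⟦ (λ x → τ x ⟦ σ ⟧) ⟧*
    ⟦⟧*-∘ []       τ σ = refl
    ⟦⟧*-∘ (t ∷ ts) τ σ = cong₂ _∷_ (⟦⟧-∘ t τ σ) (⟦⟧*-∘ ts τ σ)

  mutual
    ⟦var⟧ : ∀ t → t ⟦ var ⟧ ≡ t
    ⟦var⟧ (var x)    = refl
    ⟦var⟧ (fun f ts) = cong (fun f) (⟦var⟧* ts)

    ⟦var⟧* : ∀ {n} (ts : Vec Term n) → ts ⟦ var ⟧* ≡ ts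
    ⟦var⟧* []       = refl
    ⟦var⟧* (t ∷ ts) = cong₂ _∷_ (⟦var⟧ t) (⟦var⟧* ts)

  substX-∘ : ∀ a (τ σ : Subst) → substX σ (substX τ a) ≡ substX (λ x → τ x ⟦ σ ⟧) a
  substX-∘ (π ⟨ ts ⟩ₓ) τ σ = cong (π ⟨_⟩ₓ) (⟦⟧*-∘ ts τ σ)

  substX-var : ∀ a → substX var a ≡ a
  substX-var (π ⟨ ts ⟩ₓ) = cong (π ⟨_⟩ₓ) (⟦var⟧* ts)

  substX-cong : ∀ a {σ τ : Subst} → (∀ x → OccX x a → σ x ≡ τ x) → substX σ a ≡ substX τ a
  substX-cong (π ⟨ ts ⟩ₓ) h = cong (π ⟨_⟩ₓ) (⟦⟧*-cong ts (λ x i o → h x (occ i o)))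

  map-substX-∘ : ∀ c (τ σ : Subst) →
    map (substX σ) (map (substX τ) c) ≡ map (substX (λ x → τ x ⟦ σ ⟧)) c
  map-substX-∘ c τ σ = trans (sym (map-∘ c)) (map-cong (λ a → substX-∘ a τ σ) c)

  map-substX-var : ∀ c → map (substX var) c ≡ c
  map-substX-var c = trans (map-cong substX-var c) (map-id c)

  map-substX-cong : ∀ c {σ τ : Subst} → (∀ x → Any (OccX x) c → σ x ≡ τ x) →
    map (substX σ) c ≡ map (substX τ) c
  map-substX-cong []      h = refl
  map-substX-cong (a ∷ c) h =
    cong₂ _∷_ (substX-cong a (λ x o → h x (here o))) (map-substX-cong c (λ x o → h x (there o)))

  ren : (ℕ → ℕ) → Subst
  ren ρ x = var (ρ x)

  mutual
    Occ-ren : ∀ t ρ {x} → Occ x (t ⟦ ren ρ ⟧) → ∃ λ y → x ≡ ρ y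
    Occ-ren (var y)    ρ here      = y , refl
    Occ-ren (fun f ts) ρ (arg i o) = Occ*-ren ts ρ i o

    Occ*-ren : ∀ {n} (ts : Vec Term n) ρ i {x} → Occ x (lookup (ts ⟦ ren ρ ⟧*) i) → ∃ λ y → x ≡ ρ y
    Occ*-ren (t ∷ ts) ρ zero    o = Occ-ren t ρ o
    Occ*-ren (t ∷ ts) ρ (suc i) o = Occ*-ren ts ρ i o

  OccX-ren : ∀ a ρ {x} → OccX x (substX (ren ρ) a) → ∃ λ y → x ≡ ρ y
  OccX-ren (π ⟨ ts ⟩ₓ) ρ (occ i o) = Occ-ren (lookup ts i) ρ (subst (Occ _) (lookup-⟦⟧* ts i _) o)

  OccL-ren : ∀ c ρ {x} → Any (OccX x) (map (substX (ren ρ)) c) → ∃ λ y → x ≡ ρ y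
  OccL-ren (a ∷ c) ρ (here o)  = OccX-ren a ρ o
  OccL-ren (a ∷ c) ρ (there o) = OccL-ren c ρ o

  mutual
    maxVar : Term → ℕ
    maxVar (var x)    = x
    maxVar (fun f ts) = maxVar* ts

    maxVar* : ∀ {n} → Vec Term n → ℕ
    maxVar* []       = 0
    maxVar* (t ∷ ts) = maxVar t ⊔ maxVar* ts

  mutual
    Occ⇒≤maxVar : ∀ t {x} → Occ x t → x ≤ maxVar t
    Occ⇒≤maxVar (var x)    here      = ≤-refl
    Occ⇒≤maxVar (fun f ts) (arg i o) = Occ*⇒≤maxVar* ts i o

    Occ*⇒≤maxVar* : ∀ {n} (ts : Vec Term n) i {x} → Occ x (lookup ts i) → x ≤ maxVar* ts
    Occ*⇒≤maxVar* (t ∷ ts) zero    o = ≤-trans (Occ⇒≤maxVar t o) (m≤m⊔n _ _)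
    Occ*⇒≤maxVar* (t ∷ ts) (suc i) o = ≤-trans (Occ*⇒≤maxVar* ts i o) (m≤n⊔m (maxVar t) _)

  maxVarL : List XAtom → ℕ
  maxVarL []                  = 0
  maxVarL ((π ⟨ ts ⟩ₓ) ∷ c) = maxVar* ts ⊔ maxVarL c

  OccL⇒≤maxVarL : ∀ c {x} → Any (OccX x) c → x ≤ maxVarL c
  OccL⇒≤maxVarL ((π ⟨ ts ⟩ₓ) ∷ c) (here (occ i o)) = ≤-trans (Occ*⇒≤maxVar* ts i o) (m≤m⊔n _ _)
  OccL⇒≤maxVarL ((π ⟨ ts ⟩ₓ) ∷ c) (there o)        = ≤-trans (OccL⇒≤maxVarL c o) (m≤n⊔m (maxVar* ts) _)

  module Positions (μ : ReplacementMap) where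

    _∣ₚ_ : (s : Term) → APos μ s → Term
    _∣ₚ_ = _∣_ μ

    _[_≔_]ₚ : (s : Term) → APos μ s → Term → Term
    _[_≔_]ₚ = _[_≔_] μ

    _⟦_⟧[_≔_] : (s : Term) → Subst → APos μ s → Term → Term
    s        ⟦ σ ⟧[ root      ≔ w ] = w
    fun f ss ⟦ σ ⟧[ arg i _ p ≔ w ] = fun f ((ss ⟦ σ ⟧*) [ i ]≔ (lookup ss i ⟦ σ ⟧[ p ≔ w ]))

    [≔]-⟦⟧ : ∀ s (p : APos μ s) v σ → s [ p ≔ v ]ₚ ⟦ σ ⟧ ≡ s ⟦ σ ⟧[ p ≔ v ⟦ σ ⟧ ]
    [≔]-⟦⟧ s          root        v σ = refl
    [≔]-⟦⟧ (fun f ss) (arg i e p) v σ = cong (fun f) (trans ([]≔-⟦⟧* ss i _ σ)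
      (cong ((ss ⟦ σ ⟧*) [ i ]≔_) ([≔]-⟦⟧ (lookup ss i) p v σ)))

    ⟦⟧[≔]-cong : ∀ s (p : APos μ s) {σ τ : Subst} w → (∀ x → Occ x s → σ x ≡ τ x) →
      s ⟦ σ ⟧[ p ≔ w ] ≡ s ⟦ τ ⟧[ p ≔ w ]
    ⟦⟧[≔]-cong s          root        w h = refl
    ⟦⟧[≔]-cong (fun f ss) (arg i e p) w h = cong (fun f) (cong₂ (λ vs u → vs [ i ]≔ u)
      (⟦⟧*-cong ss (λ x j o → h x (arg j o))) (⟦⟧[≔]-cong (lookup ss i) p w (λ x o → h x (arg i o))))

    Occ-∣ : ∀ s (p : APos μ s) {x} → Occ x (s ∣ₚ p) → Occ x s
    Occ-∣ s          root        o = o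
    Occ-∣ (fun f ss) (arg i e p) o = arg i (Occ-∣ (lookup ss i) p o)

    ∣≡var⇒ActOcc : ∀ s (p : APos μ s) {x} → s ∣ₚ p ≡ var x → ActOcc μ x s
    ∣≡var⇒ActOcc s          root        refl = here
    ∣≡var⇒ActOcc (fun f ss) (arg i e p) eq   = arg i e (∣≡var⇒ActOcc (lookup ss i) p eq)

    data Frame : Set where
      frame : ∀ f (ts : Vec Term (arity f)) i → μ f i ≡ true → Frame

    plugᶠ : Frame → Term → Term
    plugᶠ (frame f ts i _) u = fun f (ts [ i ]≔ u)

    Ctx : Set
    Ctx = List Frame

    plug : Ctx → Term → Term
    plug []      u = u
    plug (F ∷ C) u = plugᶠ F (plug C u)

    plug-++ : ∀ C D u → plug (C ++ D) u ≡ plug C (plug D u)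
    plug-++ []      D u = refl
    plug-++ (F ∷ C) D u = cong (plugᶠ F) (plug-++ C D u)

    plugᶠ-lookup : ∀ {f} (ts : Vec Term (arity f)) i e → plugᶠ (frame f ts i e) (lookup ts i) ≡ fun f ts
    plugᶠ-lookup {f} ts i e = cong (fun f) ([]≔-lookup ts i)

    ArgClosed : (Term → Term → Set) → Set
    ArgClosed R = ∀ {f} (ts : Vec Term (arity f)) i {u} → μ f i ≡ true →
      R (lookup ts i) u → R (fun f ts) (fun f (ts [ i ]≔ u))

    plugᶠ-mono : ∀ {R} → ArgClosed R → ∀ F {a b} → R a b → R (plugᶠ F a) (plugᶠ F b)
    plugᶠ-mono {R} closed (frame f ts i e) {a} {b} r =
      subst (λ vs → R (fun f (ts [ i ]≔ a)) (fun f vs)) ([]≔-idempotent ts i)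
        (closed (ts [ i ]≔ a) i e (subst (λ u → R u b) (sym (lookup∘update i ts a)) r))

    plug-mono : ∀ {R} → ArgClosed R → ∀ C {a b} → R a b → R (plug C a) (plug C b)
    plug-mono closed []      r = r
    plug-mono {R} closed (F ∷ C) r = plugᶠ-mono {R} closed F (plug-mono {R} closed C r)

    plug-mono* : ∀ {R} → ArgClosed R → ∀ C {a b} → Star R a b → Star R (plug C a) (plug C b)
    plug-mono* {R} closed C = gmap (plug C) (plug-mono {R} closed C)

    args-commute : ∀ {R₁ R₂} → ArgClosed R₁ → ArgClosed R₂ →
      ∀ {f} (ts : Vec Term (arity f)) {i j u w} → μ f i ≡ true → μ f j ≡ true → i ≢ j →
      R₁ (lookup ts i) u → R₂ (lookup ts j) w →
      R₁ (fun f (ts [ j ]≔ w)) (fun f ((ts [ i ]≔ u) [ j ]≔ w)) ×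
      R₂ (fun f (ts [ i ]≔ u)) (fun f ((ts [ i ]≔ u) [ j ]≔ w))
    args-commute {R₁} {R₂} closed₁ closed₂ {f} ts {i} {j} {u} {w} eᵢ eⱼ i≢j r₁ r₂ =
      subst (λ vs → R₁ (fun f (ts [ j ]≔ w)) (fun f vs)) ([]≔-commutes ts j i (i≢j ∘ sym))
        (closed₁ (ts [ j ]≔ w) i eᵢ (subst (λ t → R₁ t u) (sym (lookup∘update′ i≢j ts w)) r₁)) ,
      closed₂ (ts [ i ]≔ u) j eⱼ (subst (λ t → R₂ t w) (sym (lookup∘update′ (i≢j ∘ sym) ts u)) r₂)

module Rewriting (S : Sig) (𝓡 : Syntax.EGTRS S) where
  open Sig S
  open Syntax S
  open EGTRS 𝓡
  open Semantics 𝓡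
  open Terms S
  open Positions μ

  infix 4 _≃_ _↦_ _≈ₑ_

  _≃_ : Term → Term → Set
  s ≃ t = ⊢ (s ≐ t)

  data _↦_ : Term → Term → Set where
    at-root : ∀ {l r c t} → Rrm (rule l r c) → ∀ σ → t ≃ l ⟦ σ ⟧ → All ⊢ (substC σ c) →
              t ↦ r ⟦ σ ⟧
    in-arg  : ∀ {f} (ts : Vec Term (arity f)) i {u} → μ f i ≡ true →
              lookup ts i ↦ u → fun f ts ↦ fun f (ts [ i ]≔ u)

  data _≈ₑ_ : Term → Term → Set where
    at-root : ∀ {l r c} → ↔E (rule l r c) → ∀ σ → All ⊢ (substC σ c) → l ⟦ σ ⟧ ≈ₑ r ⟦ σ ⟧
    in-arg  : ∀ {f} (ts : Vec Term (arity f)) i {u} → μ f i ≡ true →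
              lookup ts i ≈ₑ u → fun f ts ≈ₑ fun f (ts [ i ]≔ u)

  ≃-isEquivalence : IsEquivalence _≃_
  ≃-isEquivalence = record { refl = eq-refl _ ; sym = eq-sym ; trans = eq-trans }

  ≃-argClosed : ArgClosed _≃_
  ≃-argClosed ts i e = eq-cong _ ts i _ e

  ⟶-argClosed : ArgClosed (λ s t → ⊢ (s ⟶ t))
  ⟶-argClosed ts i e = rw-cong _ ts i _ e

  ≈ₑ-sym : ∀ {a b} → a ≈ₑ b → b ≈ₑ a
  ≈ₑ-sym (at-root (fwd e) σ cs) = at-root (bwd e) σ cs
  ≈ₑ-sym (at-root (bwd e) σ cs) = at-root (fwd e) σ cs
  ≈ₑ-sym (in-arg {f} ts i {u} e d) =
    subst (fun f (ts [ i ]≔ u) ≈ₑ_) (plugᶠ-lookup ts i e)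
      (plugᶠ-mono {_≈ₑ_} in-arg (frame f ts i e) (≈ₑ-sym d))

  ↔E-sound : ∀ {l r c} → ↔E (rule l r c) → ∀ σ → All ⊢ (substC σ c) → l ⟦ σ ⟧ ≃ r ⟦ σ ⟧
  ↔E-sound (fwd e) σ cs = eq-E e σ cs
  ↔E-sound (bwd e) σ cs = eq-sym (eq-E e σ cs)

  ≈ₑ⇒≃ : ∀ {a b} → a ≈ₑ b → a ≃ b
  ≈ₑ⇒≃ (at-root eq σ cs) = ↔E-sound eq σ cs
  ≈ₑ⇒≃ (in-arg ts i e d) = ≃-argClosed ts i e (≈ₑ⇒≃ d)

  ≈ₑ*⇒≃ : ∀ {a b} → Star _≈ₑ_ a b → a ≃ b
  ≈ₑ*⇒≃ ε        = eq-refl _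
  ≈ₑ*⇒≃ (s ◅ ss) = eq-trans (≈ₑ⇒≃ s) (≈ₑ*⇒≃ ss)

  -- The conclusion of h-rm is substX σ A′, which Agda cannot unify with a fixed atom, so the
  -- inversions below go through an equation on the atom.
  ≃⇒≈ₑ* : ∀ {s t} → s ≃ t → Star _≈ₑ_ s t
  ≃⇒≈ₑ* d = go d refl
    where
    go : ∀ {a s t} → ⊢ a → a ≡ (s ≐ t) → Star _≈ₑ_ s t
    go (eq-refl t)                     refl = ε
    go (eq-sym d)                      refl = reverse ≈ₑ-sym (go d refl)
    go (eq-trans d d′)                 refl = go d refl ◅◅ go d′ refl
    go (eq-cong f ts i u e d)          refl =
      subst (λ v → Star _≈ₑ_ v (fun f (ts [ i ]≔ u))) (plugᶠ-lookup ts i e)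
        (plug-mono* {_≈ₑ_} in-arg (frame f ts i e ∷ []) (go d refl))
    go (eq-E e σ cs)                   refl = at-root (fwd e) σ cs ◅ ε
    go (h-rm _ (rm-dep _) _ _ _)       ()
    go (h-rm _ (rm-indep _) _ _ _)     ()
    go {a = base rwP ⟨ _ ⟩ₓ}  _ ()
    go {a = base rwsP ⟨ _ ⟩ₓ} _ ()
    go {a = psP ⟨ _ ⟩ₓ}       _ ()
    go {a = psSP ⟨ _ ⟩ₓ}      _ ()
    go {a = rmP ⟨ _ ⟩ₓ}       _ ()
    go {a = rmSP ⟨ _ ⟩ₓ}      _ ()

  ⊢⟶ps⇒↦ : ∀ {s t} → ⊢ (s ⟶ps t) → s ↦ t
  ⊢⟶ps⇒↦ d = go d refl
    where
    go : ∀ {a s t} → ⊢ a → a ≡ (s ⟶ps t) → s ↦ t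
    go (ps-rule α σ _ e cs)       refl = at-root α σ e cs
    go (ps-cong f ts i u e d)      refl = in-arg ts i e (go d refl)
    go (h-rm _ (rm-dep _) _ _ _)   ()
    go (h-rm _ (rm-indep _) _ _ _) ()
    go {a = base _ ⟨ _ ⟩ₓ} _ ()
    go {a = psSP ⟨ _ ⟩ₓ}   _ ()
    go {a = rmP ⟨ _ ⟩ₓ}    _ ()
    go {a = rmSP ⟨ _ ⟩ₓ}   _ ()

  ⊢⟶⇒↦ : ∀ {s t} → ⊢ (s ⟶ t) → s ↦ t
  ⊢⟶⇒↦ d = go d refl
    where
    go : ∀ {a s t} → ⊢ a → a ≡ (s ⟶ t) → s ↦ t
    go (rw-rule α σ cs)           refl = at-root α σ (eq-refl _) cs
    go (rw-cong f ts i u e d)      refl = in-arg ts i e (go d refl)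
    go (h-rm _ (rm-dep _) _ _ _)   ()
    go (h-rm _ (rm-indep _) _ _ _) ()
    go {a = base eqP ⟨ _ ⟩ₓ}  _ ()
    go {a = base rwsP ⟨ _ ⟩ₓ} _ ()
    go {a = psP ⟨ _ ⟩ₓ}       _ ()
    go {a = psSP ⟨ _ ⟩ₓ}      _ ()
    go {a = rmP ⟨ _ ⟩ₓ}       _ ()
    go {a = rmSP ⟨ _ ⟩ₓ}      _ ()

  →R/E-split : ∀ {s t} → s →R/E t → ∃₂ λ x y → s ≃ x × x ↦ y × y ≃ t
  →R/E-split d = go d refl
    where
    go : ∀ {a s t} → ⊢ a → a ≡ (s ⟶rm t) → ∃₂ λ x y → s ≃ x × x ↦ y × y ≃ t
    go (rm-def e₁ d e₂)            refl = _ , _ , e₁ , ⊢⟶⇒↦ d , e₂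
    go (h-rm _ (rm-dep _) _ _ _)   ()
    go (h-rm _ (rm-indep _) _ _ _) ()
    go {a = base _ ⟨ _ ⟩ₓ} _ ()
    go {a = psP ⟨ _ ⟩ₓ}    _ ()
    go {a = psSP ⟨ _ ⟩ₓ}   _ ()
    go {a = rmSP ⟨ _ ⟩ₓ}   _ ()

  ↦-split : ∀ {s t} → s ↦ t → ∃₂ λ x y → s ≃ x × ⊢ (x ⟶ y) × y ≃ t
  ↦-split (at-root α σ e cs) = _ , _ , e , rw-rule α σ cs , eq-refl _
  ↦-split (in-arg ts i e d) with ↦-split d
  ... | x , y , e₁ , s , e₂ =
    _ , _ , ≃-argClosed ts i e e₁ , plugᶠ-mono {λ s t → ⊢ (s ⟶ t)} ⟶-argClosed (frame _ ts i e) s ,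
    plugᶠ-mono {_≃_} ≃-argClosed (frame _ ts i e) e₂

  ↦⇒→R/E : ∀ {s t} → s ↦ t → s →R/E t
  ↦⇒→R/E d with ↦-split d
  ... | _ , _ , e₁ , s , e₂ = rm-def e₁ s e₂

  →R/E-resp-≃ : ∀ {x x′ y y′} → x ≃ x′ → x′ →R/E y → y ≃ y′ → x →R/E y′
  →R/E-resp-≃ e₁ s e₂ with →R/E-split s
  ... | _ , _ , f₁ , d , f₂ with ↦-split d
  ... | _ , _ , g₁ , s′ , g₂ = rm-def (eq-trans e₁ (eq-trans f₁ g₁)) s′ (eq-trans g₂ (eq-trans f₂ e₂))

  open ChurchRosserModulo _↦_ _≈ₑ_ _≃_ _→R/E_ ≃-isEquivalence ≈ₑ-sym ≈ₑ⇒≃ ≃⇒≈ₑ* ↦⇒→R/E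
    →R/E-resp-≃ →R/E-split public

  ↦-redex : ∀ {l r c} → Rrm (rule l r c) → ∀ σ → All ⊢ (substC σ c) → l ⟦ σ ⟧ ↦ r ⟦ σ ⟧
  ↦-redex α σ = at-root α σ (eq-refl _)

  ↦-plug : ∀ C {a b} → a ↦ b → plug C a ↦ plug C b
  ↦-plug = plug-mono {_↦_} in-arg

  ≃-plug : ∀ C {a b} → a ≃ b → plug C a ≃ plug C b
  ≃-plug = plug-mono {_≃_} ≃-argClosed

  ↓-plug : ∀ C {a b} → a ↓ b → plug C a ↓ plug C b
  ↓-plug C (a′ , b′ , a↦*a′ , b↦*b′ , a′≃b′) =
    plug C a′ , plug C b′ , plug-mono* {_↦_} in-arg C a↦*a′ , plug-mono* {_↦_} in-arg C b↦*b′ ,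
    ≃-plug C a′≃b′

module EquationalTheory (S : Sig) (𝓡 : Syntax.EGTRS S) (isEGTRS : Syntax.Semantics.IsEGTRS S 𝓡) where
  open Syntax S
  open Semantics 𝓡
  open Rewriting S 𝓡 using (_≃_)

  Independent : Atom → Set
  Independent a = ¬ DependsOnR (predOf a)

  RmAtom-embed : ∀ {a} → Independent a → RmAtom a (embed a)
  RmAtom-embed {eqP ⟨ _ ⟩}   _  = rm-eq
  RmAtom-embed {rwP ⟨ _ ⟩}   nd = ⊥-elim (nd dep-rw)
  RmAtom-embed {rwsP ⟨ _ ⟩}  nd = ⊥-elim (nd dep-rws)
  RmAtom-embed {usr _ ⟨ _ ⟩} nd = rm-indep nd

  Pointwise-RmAtom-embed : ∀ {c} → All Independent c → Pointwise RmAtom c (map embed c)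
  Pointwise-RmAtom-embed []       = []
  Pointwise-RmAtom-embed (n ∷ ns) = RmAtom-embed n ∷ Pointwise-RmAtom-embed ns

  mutual
    ⊢E⇒⊢ : ∀ {a} → Independent a → ⊢E a → ⊢ (embed a)
    ⊢E⇒⊢ _  (eq-refl t)            = eq-refl t
    ⊢E⇒⊢ nd (eq-sym d)             = eq-sym (⊢E⇒⊢ nd d)
    ⊢E⇒⊢ nd (eq-trans d d′)        = eq-trans (⊢E⇒⊢ nd d) (⊢E⇒⊢ nd d′)
    ⊢E⇒⊢ nd (eq-cong f ts i u e d) = eq-cong f ts i u e (⊢E⇒⊢ nd d)
    ⊢E⇒⊢ _  (eq-E {c = c} e σ cs)  = eq-E e σ (conditions⇒⊢ (¬Any⇒All¬ c (isEGTRS ∘ dep-E e)) cs)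
    ⊢E⇒⊢ nd (h {c = c} hp σ cs)    =
      h-rm hp (rm-indep nd) (Pointwise-RmAtom-embed ns) σ (conditions⇒⊢ ns cs)
      where ns = ¬Any⇒All¬ c (nd ∘ dep-H hp)

    conditions⇒⊢ : ∀ {c σ} → All Independent c → All ⊢E (substCA σ c) → All ⊢ (substC σ (map embed c))
    conditions⇒⊢ {[]}              []       []       = []
    conditions⇒⊢ {(_ ⟨ _ ⟩) ∷ _} (n ∷ ns) (d ∷ ds) = ⊢E⇒⊢ n d ∷ conditions⇒⊢ ns ds

  ⊢E-of : XAtom → Set
  ⊢E-of (base π ⟨ ts ⟩ₓ) = ¬ DependsOnR π → ⊢E (π ⟨ ts ⟩)
  ⊢E-of _                = ⊤

  mutual
    ⊢⇒⊢E : ∀ {x} → ⊢ x → ⊢E-of x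
    ⊢⇒⊢E (eq-refl t)            _  = eq-refl t
    ⊢⇒⊢E (eq-sym d)             nd = eq-sym (⊢⇒⊢E d nd)
    ⊢⇒⊢E (eq-trans d d′)        nd = eq-trans (⊢⇒⊢E d nd) (⊢⇒⊢E d′ nd)
    ⊢⇒⊢E (eq-cong f ts i u e d) nd = eq-cong f ts i u e (⊢⇒⊢E d nd)
    ⊢⇒⊢E (eq-E {c = c} e σ cs)  _  =
      eq-E e σ (rm-conditions⇒⊢E ns (Pointwise-RmAtom-embed ns) cs)
      where ns = ¬Any⇒All¬ c (isEGTRS ∘ dep-E e)
    ⊢⇒⊢E (h-rm _ (rm-dep _) _ _ _) = tt
    ⊢⇒⊢E (h-rm {c = c} hp (rm-indep nd) pw σ cs) _ =
      h hp σ (rm-conditions⇒⊢E (¬Any⇒All¬ c (nd ∘ dep-H hp)) pw cs)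
    ⊢⇒⊢E {base rwP ⟨ _ ⟩ₓ}  _ nd = ⊥-elim (nd dep-rw)
    ⊢⇒⊢E {base rwsP ⟨ _ ⟩ₓ} _ nd = ⊥-elim (nd dep-rws)
    ⊢⇒⊢E {psP ⟨ _ ⟩ₓ}       _ = tt
    ⊢⇒⊢E {psSP ⟨ _ ⟩ₓ}      _ = tt
    ⊢⇒⊢E {rmP ⟨ _ ⟩ₓ}       _ = tt
    ⊢⇒⊢E {rmSP ⟨ _ ⟩ₓ}      _ = tt

    rm-⊢⇒⊢E : ∀ {a a′ σ} → Independent a → RmAtom a a′ → ⊢ (substX σ a′) → ⊢E (substA σ a)
    rm-⊢⇒⊢E n rm-eq        d = ⊢⇒⊢E d n
    rm-⊢⇒⊢E n rm-rw        _ = ⊥-elim (n dep-rw)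
    rm-⊢⇒⊢E n rm-rws       _ = ⊥-elim (n dep-rws)
    rm-⊢⇒⊢E n (rm-dep dep) _ = ⊥-elim (n dep)
    rm-⊢⇒⊢E n (rm-indep _) d = ⊢⇒⊢E d n

    rm-conditions⇒⊢E : ∀ {c c′ σ} → All Independent c → Pointwise RmAtom c c′ →
      All ⊢ (substC σ c′) → All ⊢E (substCA σ c)
    rm-conditions⇒⊢E []       []         []       = []
    rm-conditions⇒⊢E (n ∷ ns) (rm ∷ rms) (d ∷ ds) = rm-⊢⇒⊢E n rm d ∷ rm-conditions⇒⊢E ns rms ds

  =E⇒≃ : ∀ {s t} → s =E t → s ≃ t
  =E⇒≃ = ⊢E⇒⊢ isEGTRS

  ≃⇒=E : ∀ {s t} → s ≃ t → s =E t
  ≃⇒=E d = ⊢⇒⊢E d isEGTRS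

module Instances (S : Sig) (𝓡 : Syntax.EGTRS S) where
  open Sig S
  open Syntax S
  open EGTRS 𝓡
  open Semantics 𝓡
  open Terms S
  open Positions μ
  open Rewriting S 𝓡

  data StepInInstance (s : Term) (σ : Subst) : Term → Set where
    critical    : (p : APos μ s) → IsFun (s ∣ₚ p) → ∀ {l r c} → Rrm (rule l r c) → ∀ σ′ →
                  (s ∣ₚ p) ⟦ σ ⟧ ≃ l ⟦ σ′ ⟧ → All ⊢ (substC σ′ c) →
                  StepInInstance s σ (s ⟦ σ ⟧[ p ≔ r ⟦ σ′ ⟧ ])
    in-variable : (p : APos μ s) (x : ℕ) → s ∣ₚ p ≡ var x → ∀ {y} → σ x ↦ y →
                  StepInInstance s σ (s ⟦ σ ⟧[ p ≔ y ])

  StepInInstance-arg : ∀ {f} (ss : Vec Term (arity f)) i (e : μ f i ≡ true) σ {u} →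
    StepInInstance (lookup ss i) σ u → StepInInstance (fun f ss) σ (fun f ((ss ⟦ σ ⟧*) [ i ]≔ u))
  StepInInstance-arg ss i e σ (critical p isf α σ′ m cs) = critical (arg i e p) isf α σ′ m cs
  StepInInstance-arg ss i e σ (in-variable p x eqx d)    = in-variable (arg i e p) x eqx d

  mutual
    stepInInstance : ∀ s σ {w} → s ⟦ σ ⟧ ↦ w → StepInInstance s σ w
    stepInInstance (var x)    σ d                   = in-variable root x refl d
    stepInInstance (fun f ss) σ (at-root α σ′ m cs) = critical root tt α σ′ m cs
    stepInInstance (fun f ss) σ (in-arg _ i e d)    =
      StepInInstance-arg ss i e σ (stepInInstance* ss i σ d)

    stepInInstance* : ∀ {n} (ss : Vec Term n) i σ {u} → lookup (ss ⟦ σ ⟧*) i ↦ u →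
      StepInInstance (lookup ss i) σ u
    stepInInstance* (s ∷ ss) zero    σ d = stepInInstance s σ d
    stepInInstance* (s ∷ ss) (suc i) σ d = stepInInstance* ss i σ d

  ArgReduct : Bool → Term → Term → Set
  ArgReduct active t u = t ≡ u ⊎ (active ≡ true × Star _↦_ t u)

  ↦*-under : ∀ {n} (active : Fin n → Bool) (C : Vec Term n → Term) →
    (∀ vs i {u} → active i ≡ true → lookup vs i ↦ u → C vs ↦ C (vs [ i ]≔ u)) →
    ∀ ts us → (∀ i → ArgReduct (active i) (lookup ts i) (lookup us i)) → Star _↦_ (C ts) (C us)
  ↦*-under active C step [] [] _ = ε
  ↦*-under active C step (t ∷ ts) (u ∷ us) red =
    head (red zero) ◅◅
    ↦*-under (λ i → active (suc i)) (λ vs → C (u ∷ vs)) (λ vs i → step (u ∷ vs) (suc i))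
      ts us (λ i → red (suc i))
    where
    head : ArgReduct (active zero) t u → Star _↦_ (C (t ∷ ts)) (C (u ∷ ts))
    head (inj₁ refl)          = ε
    head (inj₂ (act , t↦*u)) = gmap (λ v → C (v ∷ ts)) (step (_ ∷ ts) zero act) t↦*u

  ↦*-fun : ∀ {f} (ts us : Vec Term (arity f)) →
    (∀ i → ArgReduct (μ f i) (lookup ts i) (lookup us i)) → Star _↦_ (fun f ts) (fun f us)
  ↦*-fun {f} = ↦*-under (μ f) (fun f) in-arg

  module CopyStep (σ : Subst) (x : ℕ) {y : Term} (step : σ x ↦ y) where

    σ′ : Subst
    σ′ z with z ≟ x
    ... | yes _ = y
    ... | no _  = σ z

    σ′-x : σ′ x ≡ y
    σ′-x with x ≟ x
    ... | yes _ = refl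
    ... | no x≢x = ⊥-elim (x≢x refl)

    σ′-≢ : ∀ {z} → z ≢ x → σ′ z ≡ σ z
    σ′-≢ {z} z≢x with z ≟ x
    ... | yes z≡x = ⊥-elim (z≢x z≡x)
    ... | no _    = refl

    σ↦*σ′ : ∀ z → Star _↦_ (σ z) (σ′ z)
    σ↦*σ′ z with z ≟ x
    ... | yes refl = step ◅ ε
    ... | no _     = ε

    ⟦⟧-unaffected : ∀ t → ¬ Occ x t → t ⟦ σ ⟧ ≡ t ⟦ σ′ ⟧
    ⟦⟧-unaffected t x∉t = ⟦⟧-cong t (λ z o → sym (σ′-≢ (λ { refl → x∉t o })))

    conditions-unaffected : ∀ c → ¬ Any (OccX x) c → substC σ c ≡ substC σ′ c
    conditions-unaffected c x∉c = map-substX-cong c (λ z o → sym (σ′-≢ (λ { refl → x∉c o })))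

    mutual
      ↦*-⟦⟧ : ∀ t → ¬ FrozenOcc μ x t → Star _↦_ (t ⟦ σ ⟧) (t ⟦ σ′ ⟧)
      ↦*-⟦⟧ (var z)    _       = σ↦*σ′ z
      ↦*-⟦⟧ (fun f ss) x∉frozen = ↦*-fun (ss ⟦ σ ⟧*) (ss ⟦ σ′ ⟧*) (↦*-⟦⟧-arg f ss x∉frozen)

      ↦*-⟦⟧-arg : ∀ f (ss : Vec Term (arity f)) → ¬ FrozenOcc μ x (fun f ss) →
        ∀ i → ArgReduct (μ f i) (lookup (ss ⟦ σ ⟧*) i) (lookup (ss ⟦ σ′ ⟧*) i)
      ↦*-⟦⟧-arg f ss x∉frozen i rewrite lookup-⟦⟧* ss i σ | lookup-⟦⟧* ss i σ′ with μ f i in act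
      ... | true  = inj₂ (refl , ↦*-⟦⟧* ss i (λ fo → x∉frozen (arg i fo)))
      ... | false = inj₁ (⟦⟧-unaffected (lookup ss i) (λ o → x∉frozen (frozen i act o)))

      ↦*-⟦⟧* : ∀ {n} (ss : Vec Term n) i → ¬ FrozenOcc μ x (lookup ss i) →
        Star _↦_ (lookup ss i ⟦ σ ⟧) (lookup ss i ⟦ σ′ ⟧)
      ↦*-⟦⟧* (s ∷ ss) zero    = ↦*-⟦⟧ s
      ↦*-⟦⟧* (s ∷ ss) (suc i) = ↦*-⟦⟧* ss i

    ↦*-⟦⟧[≔] : ∀ t (p : APos μ t) → t ∣ₚ p ≡ var x → ¬ FrozenOcc μ x t →
      Star _↦_ (t ⟦ σ ⟧[ p ≔ y ]) (t ⟦ σ′ ⟧)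
    ↦*-⟦⟧[≔] (var _)    root        refl _        = subst (Star _↦_ y) (sym σ′-x) ε
    ↦*-⟦⟧[≔] (fun f ss) (arg i e p) t∣p≡x x∉frozen =
      ↦*-fun ((ss ⟦ σ ⟧*) [ i ]≔ lookup ss i ⟦ σ ⟧[ p ≔ y ]) (ss ⟦ σ′ ⟧*) reduct
      where
      reduct : ∀ j → ArgReduct (μ f j) (lookup ((ss ⟦ σ ⟧*) [ i ]≔ lookup ss i ⟦ σ ⟧[ p ≔ y ]) j)
                                        (lookup (ss ⟦ σ′ ⟧*) j)
      reduct j with j Fin.≟ i
      ... | yes refl
        rewrite lookup∘update i (ss ⟦ σ ⟧*) (lookup ss i ⟦ σ ⟧[ p ≔ y ]) | lookup-⟦⟧* ss i σ′ =
        inj₂ (e , ↦*-⟦⟧[≔] (lookup ss i) p t∣p≡x (λ fo → x∉frozen (arg i fo)))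
      ... | no j≢i rewrite lookup∘update′ j≢i (ss ⟦ σ ⟧*) (lookup ss i ⟦ σ ⟧[ p ≔ y ]) =
        ↦*-⟦⟧-arg f ss x∉frozen j

module LocalPeaks (S : Sig) (𝓡 : Syntax.EGTRS S)
  (isEGTRS : Syntax.Semantics.IsEGTRS S 𝓡)
  (homCompat : Syntax.Semantics.AllHomCompat S 𝓡)
  (lccp-joinable : ∀ π → Syntax.Semantics.LCCP-R S 𝓡 π ⊎ Syntax.Semantics.LCCP-ER S 𝓡 π →
                   Syntax.Semantics.Joinable S 𝓡 π) where
  open Syntax S
  open EGTRS 𝓡
  open Semantics 𝓡
  open Terms S
  open Positions μ
  open Rewriting S 𝓡
  open EquationalTheory S 𝓡 isEGTRS using (=E⇒≃)
  open Instances S 𝓡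

  →RE*⇒↦* : ∀ {a b} → Star _→RE_ a b → Star _↦_ a b
  →RE*⇒↦* = gmap id ⊢⟶ps⇒↦

  module CriticalPeak {P : XRule → Set} {l r c} (α : P (rule l r c))
    (joinable : ∀ {α β π} → Variant P α → Variant Rrm β → VarDisjoint α β → LCCPof α β π → Joinable π)
    {σ} (cs : All ⊢ (substC σ c)) (p : APos μ l) (isf : IsFun (l ∣ₚ p))
    {l′ r′ d} (β : Rrm (rule l′ r′ d)) {σ′} (match : (l ∣ₚ p) ⟦ σ ⟧ ≃ l′ ⟦ σ′ ⟧)
    (ds : All ⊢ (substC σ′ d)) where

    N : ℕ
    N = maxVar l ⊔ maxVar r ⊔ maxVarL c

    Occ-α⇒≤N : ∀ {x} → OccRule x (rule l r c) → x ≤ N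
    Occ-α⇒≤N (in-lhs o)  = ≤-trans (Occ⇒≤maxVar l o) (≤-trans (m≤m⊔n _ _) (m≤m⊔n _ _))
    Occ-α⇒≤N (in-rhs o)  = ≤-trans (Occ⇒≤maxVar r o) (≤-trans (m≤n⊔m (maxVar l) _) (m≤m⊔n _ _))
    Occ-α⇒≤N (in-cond o) = ≤-trans (OccL⇒≤maxVarL c o) (m≤n⊔m (maxVar l ⊔ maxVar r) _)

    shift : ℕ → ℕ
    shift z = suc N + z

    shift≰N : ∀ z → ¬ shift z ≤ N
    shift≰N z le = 1+n≰n (≤-trans (s≤s (m≤m+n N z)) le)

    -- β is renamed apart by shift; θ is σ on the variables of α and σ′ on the shifted ones.
    θ : Subst
    θ z with z ≤? N
    ... | yes _ = σ z
    ... | no _  = σ′ (z ∸ suc N)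

    θ-α : ∀ {z} → z ≤ N → θ z ≡ σ z
    θ-α {z} z≤N with z ≤? N
    ... | yes _   = refl
    ... | no z≰N = ⊥-elim (z≰N z≤N)

    θ-β : ∀ z → θ (shift z) ≡ σ′ z
    θ-β z with shift z ≤? N
    ... | yes le = ⊥-elim (shift≰N z le)
    ... | no _   = cong σ′ (m+n∸m≡n (suc N) z)

    α-variant : Variant P (rule l r c)
    α-variant = subst (Variant P) renameRule-id (variant id id α)
      where
      renameRule-id : renameRule id (rule l r c) ≡ rule l r c
      renameRule-id = trans (cong₂ (λ l″ r″ → rule l″ r″ (substC var c)) (⟦var⟧ l) (⟦var⟧ r))
                            (cong (rule l r) (map-substX-var c))

    β-variant : Variant Rrm (renameRule shift (rule l′ r′ d))
    β-variant = variant shift (+-cancelˡ-≡ (suc N) _ _) β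

    Occ-β⇒shifted : ∀ {x} → OccRule x (renameRule shift (rule l′ r′ d)) → ∃ λ y → x ≡ shift y
    Occ-β⇒shifted (in-lhs o)  = Occ-ren l′ shift o
    Occ-β⇒shifted (in-rhs o)  = Occ-ren r′ shift o
    Occ-β⇒shifted (in-cond o) = OccL-ren d shift o

    disjoint : VarDisjoint (rule l r c) (renameRule shift (rule l′ r′ d))
    disjoint x oα oβ with Occ-β⇒shifted oβ
    ... | y , refl = shift≰N y (Occ-α⇒≤N oα)

    θ-on-β : ∀ t → t ⟦ ren shift ⟧ ⟦ θ ⟧ ≡ t ⟦ σ′ ⟧
    θ-on-β t = trans (⟦⟧-∘ t (ren shift) θ) (⟦⟧-cong t (λ x _ → θ-β x))

    conditions : All ⊢ (substC θ (((l ∣ₚ p) ≐ (l′ ⟦ ren shift ⟧)) ∷ c ++ substC (ren shift) d))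
    conditions =
      subst₂ _≃_ (sym match-θ) (sym (θ-on-β l′)) match ∷
      subst (All ⊢) (sym (map-++ (substX θ) c _))
        (++⁺ (subst (All ⊢) (sym c-θ) cs) (subst (All ⊢) (sym d-θ) ds))
      where
      match-θ : (l ∣ₚ p) ⟦ θ ⟧ ≡ (l ∣ₚ p) ⟦ σ ⟧
      match-θ = ⟦⟧-cong (l ∣ₚ p) (λ x o → θ-α (Occ-α⇒≤N (in-lhs (Occ-∣ l p o))))
      c-θ : substC θ c ≡ substC σ c
      c-θ = map-substX-cong c (λ x o → θ-α (Occ-α⇒≤N (in-cond o)))
      d-θ : substC θ (substC (ren shift) d) ≡ substC σ′ d
      d-θ = trans (map-substX-∘ d (ren shift) θ) (map-substX-cong d (λ x _ → θ-β x))

    left-θ : l [ p ≔ r′ ⟦ ren shift ⟧ ]ₚ ⟦ θ ⟧ ≡ l ⟦ σ ⟧[ p ≔ r′ ⟦ σ′ ⟧ ]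
    left-θ = begin
      l [ p ≔ r′ ⟦ ren shift ⟧ ]ₚ ⟦ θ ⟧    ≡⟨ [≔]-⟦⟧ l p _ θ ⟩
      l ⟦ θ ⟧[ p ≔ r′ ⟦ ren shift ⟧ ⟦ θ ⟧ ] ≡⟨ cong (λ v → l ⟦ θ ⟧[ p ≔ v ]) (θ-on-β r′) ⟩
      l ⟦ θ ⟧[ p ≔ r′ ⟦ σ′ ⟧ ]              ≡⟨ ⟦⟧[≔]-cong l p _ (λ x o → θ-α (Occ-α⇒≤N (in-lhs o))) ⟩
      l ⟦ σ ⟧[ p ≔ r′ ⟦ σ′ ⟧ ]              ∎
      where open ≡-Reasoning

    right-θ : r ⟦ θ ⟧ ≡ r ⟦ σ ⟧
    right-θ = ⟦⟧-cong r (λ x o → θ-α (Occ-α⇒≤N (in-rhs o)))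

    critical-↓ : l ⟦ σ ⟧[ p ≔ r′ ⟦ σ′ ⟧ ] ↓ r ⟦ σ ⟧
    critical-↓ with joinable α-variant β-variant disjoint (lccp p isf) θ conditions
    ... | u , u′ , left↠u , right↠u′ , u=u′ =
      u , u′ , subst (λ v → Star _↦_ v u) left-θ (→RE*⇒↦* left↠u) ,
      subst (λ v → Star _↦_ v u′) right-θ (→RE*⇒↦* right↠u′) , =E⇒≃ u=u′

  Rrm-homCompat : ∀ {l r c′} → Rrm (rule l r c′) →
    ∃ λ c → Pointwise RmAtom c c′ × LeftHomogeneous l × Compatible l r c
  Rrm-homCompat (rrm α pw) = _ , pw , proj₁ homCompat α

  ↔E-homCompat : ∀ {l r c′} → ↔E (rule l r c′) →
    ∃ λ c → c′ ≡ map embed c × LeftHomogeneous l × Compatible l r c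
  ↔E-homCompat (fwd e) = _ , refl , proj₁ (proj₂ homCompat e)
  ↔E-homCompat (bwd e) = _ , refl , proj₂ (proj₂ homCompat e)

  OccX-rm : ∀ {c c′ x} → Pointwise RmAtom c c′ → Any (OccX x) c′ → Any (OccA x) c
  OccX-rm (rm-eq        ∷ _)   (here (occ i o)) = here (occ i o)
  OccX-rm (rm-rw        ∷ _)   (here (occ i o)) = here (occ i o)
  OccX-rm (rm-rws       ∷ _)   (here (occ i o)) = here (occ i o)
  OccX-rm (rm-dep _     ∷ _)   (here (occ i o)) = here (occ i o)
  OccX-rm (rm-indep _   ∷ _)   (here (occ i o)) = here (occ i o)
  OccX-rm (_            ∷ pw)  (there o)        = there (OccX-rm pw o)

  OccX-embed : ∀ c {x} → Any (OccX x) (map embed c) → Any (OccA x) c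
  OccX-embed ((π ⟨ ts ⟩) ∷ c) (here (occ i o)) = here (occ i o)
  OccX-embed (_ ∷ c)          (there o)        = there (OccX-embed c o)

  module VariablePeak {l r c} (hom : LeftHomogeneous l) (compat : Compatible l r c)
    (σ : Subst) (p : APos μ l) {x} (l∣p≡x : l ∣ₚ p ≡ var x) {y} (step : σ x ↦ y) where
    open CopyStep σ x step public

    x-active : ActOcc μ x l
    x-active = ∣≡var⇒ActOcc l p l∣p≡x

    lhs↦* : Star _↦_ (l ⟦ σ ⟧[ p ≔ y ]) (l ⟦ σ′ ⟧)
    lhs↦* = ↦*-⟦⟧[≔] l p l∣p≡x (hom x x-active)

    rhs↦* : Star _↦_ (r ⟦ σ ⟧) (r ⟦ σ′ ⟧)
    rhs↦* = ↦*-⟦⟧ r (proj₁ (compat x x-active))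

    x∉c : ¬ Any (OccA x) c
    x∉c = proj₂ (compat x x-active)

  variable-peak-R : ∀ {l r c} → Rrm (rule l r c) → ∀ σ → All ⊢ (substC σ c) →
    (p : APos μ l) (x : ℕ) → l ∣ₚ p ≡ var x → ∀ {y} → σ x ↦ y → l ⟦ σ ⟧[ p ≔ y ] ↓ r ⟦ σ ⟧
  variable-peak-R {c = c} α σ cs p x l∣p≡x step with Rrm-homCompat α
  ... | _ , pw , hom , compat = _ , _ , lhs↦* ◅◅ (↦-redex α σ′ cs′ ◅ ε) , rhs↦* , eq-refl _
    where
    open VariablePeak hom compat σ p l∣p≡x step
    cs′ : All ⊢ (substC σ′ c)
    cs′ = subst (All ⊢) (conditions-unaffected c (x∉c ∘ OccX-rm pw)) cs

  variable-peak-E : ∀ {l r c} → ↔E (rule l r c) → ∀ σ → All ⊢ (substC σ c) →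
    (p : APos μ l) (x : ℕ) → l ∣ₚ p ≡ var x → ∀ {y} → σ x ↦ y → l ⟦ σ ⟧[ p ≔ y ] ↓ r ⟦ σ ⟧
  variable-peak-E eq σ cs p x l∣p≡x step with ↔E-homCompat eq
  ... | c , refl , hom , compat = _ , _ , lhs↦* , rhs↦* , ↔E-sound eq σ′ cs′
    where
    open VariablePeak hom compat σ p l∣p≡x step
    cs′ : All ⊢ (substC σ′ (map embed c))
    cs′ = subst (All ⊢) (conditions-unaffected (map embed c) (x∉c ∘ OccX-embed c)) cs

  root-peak-R : ∀ {l r c} → Rrm (rule l r c) → ∀ σ → All ⊢ (substC σ c) →
    ∀ {w} → l ⟦ σ ⟧ ↦ w → w ↓ r ⟦ σ ⟧
  root-peak-R {l} α σ cs s with stepInInstance l σ s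
  ... | critical p isf β σ′ m ds = CriticalPeak.critical-↓ α
          (λ va vb dj lc → lccp-joinable _ (inj₁ (mk va vb dj lc))) cs p isf β m ds
  ... | in-variable p x l∣p≡x step = variable-peak-R α σ cs p x l∣p≡x step

  root-peak-E : ∀ {l r c} → ↔E (rule l r c) → ∀ σ → All ⊢ (substC σ c) →
    ∀ {w} → l ⟦ σ ⟧ ↦ w → w ↓ r ⟦ σ ⟧
  root-peak-E {l} eq σ cs s with stepInInstance l σ s
  ... | critical p isf β σ′ m ds = CriticalPeak.critical-↓ eq
          (λ va vb dj lc → lccp-joinable _ (inj₂ (mk va vb dj lc))) cs p isf β m ds
  ... | in-variable p x l∣p≡x step = variable-peak-E eq σ cs p x l∣p≡x step

  locallyCoherent : LocallyCoherent
  locallyCoherent (at-root eq σ cs) s = root-peak-E eq σ cs s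
  locallyCoherent x≈y@(in-arg _ _ _ _) (at-root β σ′ m ds) =
    ↦*⇒↓ (at-root β σ′ (eq-trans (eq-sym (≈ₑ⇒≃ x≈y)) m) ds ◅ ε)
  locallyCoherent (in-arg {f} ts i e x≈u) (in-arg _ j e′ s) with i Fin.≟ j
  ... | yes refl = ↓-plug (frame f ts i e ∷ []) (locallyCoherent x≈u s)
  ... | no i≢j with args-commute {_≈ₑ_} {_↦_} in-arg in-arg ts e e′ i≢j x≈u s
  ...   | w≈v , y↦v = _ , _ , ε , y↦v ◅ ε , ≈ₑ⇒≃ w≈v

  record RedexContext (X Y : Term) : Set where
    constructor redex
    field
      context   : Ctx
      {Z l r}   : Term
      {c}       : List XAtom
      rule∈     : Rrm (rule l r c)
      σ         : Subst
      match     : Z ≃ l ⟦ σ ⟧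
      holds     : All ⊢ (substC σ c)
      source≡   : X ≡ plug context Z
      target≡   : Y ≡ plug context (r ⟦ σ ⟧)

  ↦-redexContext : ∀ {X Y} → X ↦ Y → RedexContext X Y
  ↦-redexContext (at-root α σ m cs) = redex [] α σ m cs refl refl
  ↦-redexContext (in-arg ts i e s) with ↦-redexContext s
  ... | redex O α σ m cs source≡ target≡ =
    redex (F ∷ O) α σ m cs (trans (sym (plugᶠ-lookup ts i e)) (cong (plugᶠ F) source≡))
      (cong (plugᶠ F) target≡)
    where F = frame _ ts i e

length-∷ʳ-+ : ∀ {A : Set} (xs : List A) x k → length (xs ++ x ∷ []) + k ≡ length xs + suc k
length-∷ʳ-+ xs x k = trans (cong (_+ k) (length-++ xs)) (+-assoc (length xs) 1 k)

module LocalConfluence (S : Sig) (𝓡 : Syntax.EGTRS S)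
  (isEGTRS : Syntax.Semantics.IsEGTRS S 𝓡)
  (homCompat : Syntax.Semantics.AllHomCompat S 𝓡)
  (lccp-joinable : ∀ π → Syntax.Semantics.LCCP-R S 𝓡 π ⊎ Syntax.Semantics.LCCP-ER S 𝓡 π →
                   Syntax.Semantics.Joinable S 𝓡 π)
  (terminating : Syntax.Semantics.ETerminating S 𝓡) where
  open Syntax S
  open EGTRS 𝓡
  open Semantics 𝓡
  open Terms S
  open Positions μ
  open Rewriting S 𝓡
  open LocalPeaks S 𝓡 isEGTRS homCompat lccp-joinable

  module _ (t : Term) (ih : ChurchRosserBelow t) where
    open Below terminating t ih

    -- A step at the root of I turns a syntactic peak into a matched one under the shorter
    -- context O; the two kinds are proved by simultaneous induction on the length of the context.
    SyntacticPeaks : ℕ → Set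
    SyntacticPeaks n = ∀ O I → length O + length I < n → ∀ {l r c} → Rrm (rule l r c) →
      ∀ σ → All ⊢ (substC σ c) → plug O (plug I (l ⟦ σ ⟧)) ≃ t →
      ∀ {V} → plug I (l ⟦ σ ⟧) ↦ V → plug O (plug I (r ⟦ σ ⟧)) ↓ plug O V

    MatchedPeaks : ℕ → Set
    MatchedPeaks n = ∀ O → length O < n → ∀ {Z l r c} → Rrm (rule l r c) →
      ∀ σ → Z ≃ l ⟦ σ ⟧ → All ⊢ (substC σ c) → plug O Z ≃ t →
      ∀ {Y} → Star _↦_ (plug O Z) Y → plug O (r ⟦ σ ⟧) ↓ Y

    InContext : Ctx → Term → Term → Set
    InContext O W w = ∃ λ v → w ≡ plug O v × v ≃ W

    label-chain : ∀ O {Z W} → Star _≈ₑ_ Z W →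
      Star (λ a b → InContext O W a × a ≈ₑ b) (plug O Z) (plug O W)
    label-chain O ε        = ε
    label-chain O (s ◅ ss) =
      ((_ , refl , ≈ₑ*⇒≃ (s ◅ ss)) , plug-mono {_≈ₑ_} in-arg O s) ◅ label-chain O ss

    matchedPeaks : ∀ n → SyntacticPeaks n → MatchedPeaks n
    matchedPeaks n syntactic O |O|<n {Z} {l} {r} α σ Z≃lσ cs inRegion =
      ↓-along-redex-chain locallyCoherent contract
        (syntactic [] O |O|<n α σ cs (eq-trans (≃-plug O (eq-sym Z≃lσ)) inRegion))
        inRegion (label-chain O (≃⇒≈ₑ* Z≃lσ)) (l ⟦ σ ⟧ , refl , eq-refl _)
      where
      contract : ∀ {w} → InContext O (l ⟦ σ ⟧) w → w ↦ plug O (r ⟦ σ ⟧)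
      contract (v , refl , v≃lσ) = ↦-plug O (at-root α σ v≃lσ cs)

    syntacticPeaks-suc : ∀ m → MatchedPeaks m → SyntacticPeaks (suc m)
    syntacticPeaks-suc m matched O [] _ α σ cs _ s = ↓-sym (↓-plug O (root-peak-R α σ cs s))
    syntacticPeaks-suc m matched O (F@(frame f ts i e) ∷ I) lt α σ cs inRegion (at-root β σ′ m′ ds) =
      ↓-sym (matched O |O|<m β σ′ m′ ds inRegion (↦-plug O (↦-plug (F ∷ I) (↦-redex α σ cs)) ◅ ε))
      where
      |O|<m : length O < m
      |O|<m = m+n≤o⇒m≤o (suc (length O)) (subst (_≤ m) (+-suc (length O) (length I)) (≤-pred lt))
    syntacticPeaks-suc m matched O (F@(frame f ts i e) ∷ I) lt {l} {r} α σ cs inRegion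
                       (in-arg _ j {u} e′ s) with j Fin.≟ i
    ... | yes refl =
      subst₂ _↓_ (plug-++ O (F ∷ []) Rσ) target≡
        (syntacticPeaks-suc m matched (O ++ F ∷ []) I lt′ α σ cs inRegion′ (subst (_↦ u) (lookup∘update i ts Lσ) s))
      where
      Lσ = plug I (l ⟦ σ ⟧)
      Rσ = plug I (r ⟦ σ ⟧)
      lt′ : length (O ++ F ∷ []) + length I < suc m
      lt′ = subst (_< suc m) (sym (length-∷ʳ-+ O F (length I))) lt
      inRegion′ : plug (O ++ F ∷ []) Lσ ≃ t
      inRegion′ = subst (_≃ t) (sym (plug-++ O (F ∷ []) Lσ)) inRegion
      target≡ : plug (O ++ F ∷ []) u ≡ plug O (fun f ((ts [ i ]≔ Lσ) [ i ]≔ u))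
      target≡ = trans (plug-++ O (F ∷ []) u) (cong (λ vs → plug O (fun f vs)) (sym ([]≔-idempotent ts i)))
    ... | no j≢i = ↓-plug O (_ , _ , redex-side ◅ ε , other-side ◅ ε , eq-refl _)
      where
      Lσ = plug I (l ⟦ σ ⟧)
      Rσ = plug I (r ⟦ σ ⟧)
      redex↦ : lookup (ts [ i ]≔ Lσ) i ↦ Rσ
      redex↦ = subst (_↦ Rσ) (sym (lookup∘update i ts Lσ)) (↦-plug I (↦-redex α σ cs))
      commuted = args-commute {_↦_} {_↦_} in-arg in-arg (ts [ i ]≔ Lσ) e e′ (j≢i ∘ sym) redex↦ s
      redex-side : fun f (ts [ i ]≔ Rσ) ↦ fun f (((ts [ i ]≔ Lσ) [ i ]≔ Rσ) [ j ]≔ u)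
      redex-side = subst (λ vs → fun f vs ↦ fun f (((ts [ i ]≔ Lσ) [ i ]≔ Rσ) [ j ]≔ u))
                     ([]≔-idempotent ts i) (proj₂ commuted)
      other-side = proj₁ commuted

    syntacticPeaks : ∀ n → SyntacticPeaks n
    syntacticPeaks zero    _ _ ()
    syntacticPeaks (suc m) = syntacticPeaks-suc m (matchedPeaks m (syntacticPeaks m))

    locallyConfluentAt : LocallyConfluentAt t
    locallyConfluentAt t₀≃t s t₀↦*b with ↦-redexContext s
    ... | redex O α σ m cs refl refl =
      matchedPeaks (suc (length O)) (syntacticPeaks _) O ≤-refl α σ m cs t₀≃t t₀↦*b
open Syntax
open Semantics

corollary11p5 : (S : Sig) (𝓡 : EGTRS S) →
    IsEGTRS S 𝓡 →
    ETerminating S 𝓡 →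
    AllHomCompat S 𝓡 →
    (∀ (π : CondPair S) → LCCP-R S 𝓡 π ⊎ LCCP-ER S 𝓡 π → Joinable S 𝓡 π) →
    EConfluent S 𝓡
corollary11p5 S 𝓡 isEGTRS terminating homCompat lccp-joinable = eConfluent
  where
  open Rewriting S 𝓡
  open LocalPeaks S 𝓡 isEGTRS homCompat lccp-joinable
  open LocalConfluence S 𝓡 isEGTRS homCompat lccp-joinable terminating
  open EquationalTheory S 𝓡 isEGTRS using (≃⇒=E)

  eConfluent : EConfluent S 𝓡
  eConfluent t↠t₁ t↠t₂
    with confluentModulo terminating
           (churchRosser terminating locallyCoherent locallyConfluentAt) t↠t₁ t↠t₂
  ... | t₁′ , t₂′ , t₁↠t₁′ , t₂↠t₂′ , t₁′≃t₂′ = t₁′ , t₂′ , t₁↠t₁′ , t₂↠t₂′ , ≃⇒=E t₁′≃t₂′
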